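{- Let $F(u)=C(x,y,z,u)$, $G(u)=C(x,z,y,u)$ and $q=yz$. Then \[ F(u)=\sum_{n\ge 0}\frac{(x^2y^2u^4)^n q^{2n^2}}{(yu;q)_n (qu;q)_n} \left( xy q^n u+\frac{xy q^n u}{1-yq^n u}\, G(1) -\frac{x^2y^2 q^{1+3n}u^3}{1-yq^n u} -\frac{x^2y^2 q^{1+3n}u^3}{(1-yq^n u)(1-q^{n+1}u)}\, F(1) \right), \] and $G(u)$ satisfies the analogous formula obtained by interchanging $y$ and $z$ and interchanging $F(1)$ and $G(1)$.
   Context: A Catalan word of length $n\geq1$ is a sequence $w_1\cdots w_n$ of nonnegative integers with $w_1=0$ and $w_i\leq w_{i-1}+1$; its Catalan polyomino is the bargraph whose $i$th column has $w_i+1$ cells, columns bottom-aligned; $\mathbf{C}$ is the set of all Catalan polyominoes. For $P\in\mathbf{C}$: $\mathrm{lth}(P)$ = number of columns, $\mathrm{last}(P)$ = number of cells in the last column, $\mathrm{ver}(P)$ = total number of cells in columns of odd index (first column index 1), $\mathrm{white}(P)$ = total number of cells in columns of even index. $s(P)=\mathrm{ver}(P)$ if $\mathrm{lth}(P)$ odd, $s(P)=\mathrm{white}(P)$ if even; $\bar s(P)=\mathrm{ver}(P)$ if $\mathrm{lth}(P)$ even, $\bar s(P)=\mathrm{white}(P)$ if odd. $C(x,y,z,u)=\sum_{P\in\mathbf{C}}x^{\mathrm{lth}(P)}y^{s(P)}z^{\bar s(P)}u^{\mathrm{last}(P)}$. $(a;q)_n=\prod_{k=0}^{n-1}(1-aq^k)$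 with $(a;q)_0=1$. -}

module Defs where

open import Data.Nat as ℕ using (ℕ; zero; suc; _∸_; _≡ᵇ_)
open import Data.Integer as ℤ using (ℤ; +_; 0ℤ; 1ℤ)
open import Data.Bool using (Bool; true; false; if_then_else_; _∧_)
open import Data.List using (List; []; _∷_; _++_; map; concatMap; upTo; filterᵇ; length)

-- Catalan words / Catalan polyominoes
-- A Catalan polyomino is represented by its Catalan word w₁⋯wₙ
-- (column i has wᵢ + 1 cells).

lastOr0 : List ℕ → ℕ
lastOr0 []           = 0
lastOr0 (v ∷ [])     = v
lastOr0 (v ∷ w ∷ ws) = lastOr0 (w ∷ ws)

extend : List ℕ → List (List ℕ)
extend w = map (λ v → w ++ (v ∷ [])) (upTo (suc (suc (lastOr0 w))))

catWords : ℕ → List (List ℕ)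
catWords zero          = []
catWords (suc zero)    = (0 ∷ []) ∷ []
catWords (suc (suc n)) = concatMap extend (catWords (suc n))

-- cells in the columns at odd / even positions (positions start at 1)
oddCells evenCells : List ℕ → ℕ
oddCells []        = 0
oddCells (v ∷ vs)  = suc v ℕ.+ evenCells vs
evenCells []       = 0
evenCells (v ∷ vs) = oddCells vs

isOdd : ℕ → Bool
isOdd zero    = false
isOdd (suc n) = if isOdd n then false else true

lth : List ℕ → ℕ
lth = length

ver white last : List ℕ → ℕ
ver   = oddCells
white = evenCells
last w = suc (lastOr0 w)

s s̄ : List ℕ → ℕ
s  w = if isOdd (lth w) then ver w else white w
s̄ w = if isOdd (lth w) then white w else ver w

-- Formal power series in x, y, z, u over ℤ:
-- f a b c d = coefficient of x^a y^b z^c u^d.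

PS : Set
PS = ℕ → ℕ → ℕ → ℕ → ℤ

countC : ℕ → ℕ → ℕ → ℕ → ℕ
countC a b c d = length (filterᵇ
  (λ w → (s w ≡ᵇ b) ∧ (s̄ w ≡ᵇ c) ∧ (last w ≡ᵇ d)) (catWords a))

countC1 : ℕ → ℕ → ℕ → ℕ
countC1 a b c = length (filterᵇ
  (λ w → (s w ≡ᵇ b) ∧ (s̄ w ≡ᵇ c)) (catWords a))

C : PS
C a b c d = + countC a b c d

-- C(x,y,z,1) = Σ_P x^lth y^s z^s̄
C₁ : PS
C₁ a b c d = if d ≡ᵇ 0 then + countC1 a b c else 0ℤ

F G F1 G1 : PS
F = C
G a b c d = C a c b d
F1 = C₁
G1 a b c d = C₁ a c b d

sumTo : ℕ → (ℕ → ℤ) → ℤ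
sumTo zero    f = f 0
sumTo (suc n) f = sumTo n f ℤ.+ f (suc n)

infixl 6 _⊕_ _⊖_
infixl 7 _⊗_
infixr 8 _^ˢ_

_⊕_ _⊖_ _⊗_ : PS → PS → PS
(f ⊕ g) a b c d = f a b c d ℤ.+ g a b c d
(f ⊖ g) a b c d = f a b c d ℤ.- g a b c d
(f ⊗ g) a b c d =
  sumTo a λ i → sumTo b λ j → sumTo c λ k → sumTo d λ l →
    f i j k l ℤ.* g (a ∸ i) (b ∸ j) (c ∸ k) (d ∸ l)

mono : ℕ → ℕ → ℕ → ℕ → PS
mono α β γ δ a b c d =
  if (a ≡ᵇ α) ∧ (b ≡ᵇ β) ∧ (c ≡ᵇ γ) ∧ (d ≡ᵇ δ) then 1ℤ else 0ℤ

𝟙 X Y Z U : PS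
𝟙 = mono 0 0 0 0
X = mono 1 0 0 0
Y = mono 0 1 0 0
Z = mono 0 0 1 0
U = mono 0 0 0 1

_^ˢ_ : PS → ℕ → PS
f ^ˢ zero  = 𝟙
f ^ˢ suc n = f ⊗ f ^ˢ n

-- 1 / (1 - m), for a series m with zero constant term:
-- Σ_k m^k (m^k has total degree ≥ k, so only k ≤ a+b+c+d contribute)
1/1-_ : PS → PS
(1/1- m) a b c d = sumTo (a ℕ.+ b ℕ.+ c ℕ.+ d) λ k → (m ^ˢ k) a b c d

prodTo : ℕ → (ℕ → PS) → PS
prodTo zero    f = 𝟙
prodTo (suc n) f = prodTo n f ⊗ f n

-- 1 / (a;q)_n = Π_{k<n} 1/(1 - a q^k)   (a, q without constant term)
1/qPoch : PS → PS → ℕ → PS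
1/qPoch a q n = prodTo n λ k → 1/1- (a ⊗ q ^ˢ k)

-- Σ_{n ≥ 0} T n, for a family with T n of total degree ≥ n
-- (so only n ≤ a+b+c+d contribute to the coefficient of x^a y^b z^c u^d)
Σₙ : (ℕ → PS) → PS
Σₙ T a b c d = sumTo (a ℕ.+ b ℕ.+ c ℕ.+ d) λ n → T n a b c d

-- Right-hand side of Theorem 5.5, with y ↦ y', z ↦ z', and
-- f1 in the F(1)-slot, g1 in the G(1)-slot; q = y z.

RHS : PS → PS → PS → PS → PS
RHS y z f1 g1 = Σₙ λ n →
  let q  = y ⊗ z
      qn = q ^ˢ n
      A  = X ⊗ y ⊗ qn ⊗ U
      B  = X ⊗ X ⊗ y ⊗ y ⊗ q ^ˢ (1 ℕ.+ 3 ℕ.* n) ⊗ U ⊗ U ⊗ U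
      D  = 1/1- (y ⊗ qn ⊗ U)
  in (X ⊗ X ⊗ y ⊗ y ⊗ U ⊗ U ⊗ U ⊗ U) ^ˢ n ⊗ q ^ˢ (2 ℕ.* n ℕ.* n)
       ⊗ 1/qPoch (y ⊗ U) q n ⊗ 1/qPoch (q ⊗ U) q n
       ⊗ (A ⊕ A ⊗ D ⊗ g1 ⊖ B ⊗ D
            ⊖ B ⊗ D ⊗ (1/1- (q ^ˢ (suc n) ⊗ U)) ⊗ f1)

_≈ˢ_ : PS → PS → Set
f ≈ˢ g = ∀ a b c d → f a b c d ≡ g a b c d
  where open import Relation.Binary.PropositionalEquality using (_≡_)

{-# OPTIONS --safe #-}
module Submission where

-- A Catalan word of length at least 2 is a word w followed by a last column of height
-- h ≤ last w + 1, and appending that column turns the pair (s, s̄) of w into (s̄ + h, s).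
-- So for H = F(yⁱzʲu), with t = y^(i+1) zʲ u the weight of one cell of the new column and
-- H′ = G(y^(i+1) zʲ u), summing the geometric series over h gives the kernel equation
--   (1 − t) H = x t (1 − t + G(1) − t H′),
-- and symmetrically for G. Solving it for F(qⁿu) and then for G(y qⁿ u) writes F(qⁿu) as the
-- n-th summand of the formula plus F(qⁿ⁺¹u) times a series divisible by x²u⁴. Iterating, the
-- remainder has unbounded order and the accumulated multipliers are the q-Pochhammer prefactors.

open import Defs
open import Algebra.Bundles using (CommutativeRing)
open import Algebra.Structures using (IsCommutativeRing; IsAbelianGroup)
import Algebra.Construct.Pointwise as Pointwise
import Algebra.Construct.Subst.Equality as SubstEquality
open import Algebra.Solver.Ring.AlmostCommutativeRing using (fromCommutativeRing; _-Raw-AlmostCommutative⟶_)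
open import Data.Bool as Bool using (Bool; true; false; if_then_else_; _∧_)
open import Data.Bool.Properties using (∧-assoc; ∧-comm; ∧-identityʳ; ∧-zeroʳ; T?)
open import Data.Integer as ℤ using (ℤ; +_; 0ℤ; 1ℤ)
import Data.Integer.Properties as ℤₚ
open import Data.List using (List; []; _∷_; _++_; _∷ʳ_; map; concatMap; upTo; filterᵇ; length)
open import Data.List.Properties using (upTo-∷ʳ; length-++; filter-≐)
open import Data.Maybe using (Maybe; just; nothing)
open import Data.Nat as ℕ using (ℕ; zero; suc; _∸_; _≤_; _<_; z≤n; s≤s; _≡ᵇ_)
import Data.Nat.Properties as ℕₚ
open import Data.Nat.Tactic.RingSolver using (solve-∀)
open import Data.Product using (_×_; _,_)
open import Data.Sum using (inj₁; inj₂)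
open import Function using (_∘_)
open import Level using (0ℓ)
import Relation.Binary.Reasoning.Setoid
open import Relation.Binary.PropositionalEquality as ≡ using (_≡_; refl; cong; cong₂)
open import Relation.Nullary using (yes; no)

foldUpTo : ∀ {a} {A : Set a} → (A → A → A) → ℕ → (ℕ → A) → A
foldUpTo _∙_ zero    f = f 0
foldUpTo _∙_ (suc n) f = foldUpTo _∙_ n f ∙ f (suc n)

foldUpTo-pointwise : ∀ {a} {A : Set a} (_∙_ : A → A → A) n (f : ℕ → ℕ → A) m →
  foldUpTo (λ g h k → g k ∙ h k) n f m ≡ foldUpTo _∙_ n (λ i → f i m)
foldUpTo-pointwise _∙_ zero    f m = refl
foldUpTo-pointwise _∙_ (suc n) f m = cong (_∙ f (suc n) m) (foldUpTo-pointwise _∙_ n f m)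

module PowerSeries {c ℓ} (R : CommutativeRing c ℓ) where

  open CommutativeRing R renaming (refl to ≈-refl)
  open import Relation.Binary.Reasoning.Setoid setoid

  Σ≤ : ℕ → (ℕ → Carrier) → Carrier
  Σ≤ = foldUpTo _+_

  Σ≤-cong : ∀ n {f g : ℕ → Carrier} → (∀ i → i ≤ n → f i ≈ g i) → Σ≤ n f ≈ Σ≤ n g
  Σ≤-cong zero    f≈g = f≈g 0 z≤n
  Σ≤-cong (suc n) f≈g = +-cong (Σ≤-cong n λ i i≤n → f≈g i (ℕₚ.m≤n⇒m≤1+n i≤n)) (f≈g (suc n) ℕₚ.≤-refl)

  Σ≤-zero : ∀ n {f : ℕ → Carrier} → (∀ i → f i ≈ 0#) → Σ≤ n f ≈ 0#
  Σ≤-zero zero    f≈0 = f≈0 0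
  Σ≤-zero (suc n) f≈0 = trans (+-cong (Σ≤-zero n f≈0) (f≈0 (suc n))) (+-identityˡ 0#)

  Σ≤-distrib-+ : ∀ n (f g : ℕ → Carrier) → Σ≤ n (λ i → f i + g i) ≈ Σ≤ n f + Σ≤ n g
  Σ≤-distrib-+ zero    f g = ≈-refl
  Σ≤-distrib-+ (suc n) f g = trans (+-congʳ (Σ≤-distrib-+ n f g)) (interchange _ _ _ _)
    where open import Algebra.Properties.CommutativeSemigroup +-commutativeSemigroup using (interchange)

  *-distribˡ-Σ≤ : ∀ n x (f : ℕ → Carrier) → x * Σ≤ n f ≈ Σ≤ n (λ i → x * f i)
  *-distribˡ-Σ≤ zero    x f = ≈-refl
  *-distribˡ-Σ≤ (suc n) x f = trans (distribˡ x _ _) (+-congʳ (*-distribˡ-Σ≤ n x f))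

  *-distribʳ-Σ≤ : ∀ n x (f : ℕ → Carrier) → Σ≤ n f * x ≈ Σ≤ n (λ i → f i * x)
  *-distribʳ-Σ≤ zero    x f = ≈-refl
  *-distribʳ-Σ≤ (suc n) x f = trans (distribʳ x _ _) (+-congʳ (*-distribʳ-Σ≤ n x f))

  Σ≤-suc : ∀ n (f : ℕ → Carrier) → Σ≤ (suc n) f ≈ f 0 + Σ≤ n (λ i → f (suc i))
  Σ≤-suc zero    f = ≈-refl
  Σ≤-suc (suc n) f = trans (+-congʳ (Σ≤-suc n f)) (+-assoc _ _ _)

  Σ≤-reverse : ∀ n (f : ℕ → Carrier) → Σ≤ n f ≈ Σ≤ n (λ i → f (n ∸ i))
  Σ≤-reverse zero    f = ≈-refl
  Σ≤-reverse (suc n) f = begin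
    Σ≤ n f + f (suc n)                   ≈⟨ +-comm _ _ ⟩
    f (suc n) + Σ≤ n f                   ≈⟨ +-congˡ (Σ≤-reverse n f) ⟩
    f (suc n) + Σ≤ n (λ i → f (n ∸ i))   ≈⟨ Σ≤-suc n (λ i → f (suc n ∸ i)) ⟨
    Σ≤ (suc n) (λ i → f (suc n ∸ i))     ∎

  Σ≤-triangle : ∀ n (f : ℕ → ℕ → Carrier) →
    Σ≤ n (λ k → Σ≤ k (λ i → f i k)) ≈ Σ≤ n (λ i → Σ≤ (n ∸ i) (λ j → f i (i ℕ.+ j)))
  Σ≤-triangle zero    f = ≈-refl
  Σ≤-triangle (suc n) f = begin
    Σ≤ n (λ k → Σ≤ k (λ i → f i k)) + Σ≤ (suc n) (λ i → f i (suc n))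
      ≈⟨ +-cong (Σ≤-triangle n f) ≈-refl ⟩
    Σ≤ n (λ i → Σ≤ (n ∸ i) (λ j → f i (i ℕ.+ j))) + (Σ≤ n (λ i → f i (suc n)) + f (suc n) (suc n))
      ≈⟨ +-assoc _ _ _ ⟨
    Σ≤ n (λ i → Σ≤ (n ∸ i) (λ j → f i (i ℕ.+ j))) + Σ≤ n (λ i → f i (suc n)) + f (suc n) (suc n)
      ≈⟨ +-cong (Σ≤-distrib-+ n _ _) last-row ⟨
    Σ≤ n (λ i → Σ≤ (n ∸ i) (λ j → f i (i ℕ.+ j)) + f i (suc n)) + Σ≤ (n ∸ n) (λ j → f (suc n) (suc n ℕ.+ j))
      ≈⟨ +-congʳ (Σ≤-cong n row) ⟩
    Σ≤ n (λ i → Σ≤ (suc n ∸ i) (λ j → f i (i ℕ.+ j))) + Σ≤ (n ∸ n) (λ j → f (suc n) (suc n ℕ.+ j)) ∎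
    where
    last-row : Σ≤ (n ∸ n) (λ j → f (suc n) (suc n ℕ.+ j)) ≈ f (suc n) (suc n)
    last-row rewrite ℕₚ.n∸n≡0 n | ℕₚ.+-identityʳ n = ≈-refl
    row : ∀ i → i ≤ n →
      Σ≤ (n ∸ i) (λ j → f i (i ℕ.+ j)) + f i (suc n) ≈ Σ≤ (suc n ∸ i) (λ j → f i (i ℕ.+ j))
    row i i≤n rewrite ℕₚ.+-∸-assoc 1 i≤n
      = +-congˡ (reflexive (cong (f i) (≡.sym (≡.trans (ℕₚ.+-suc i (n ∸ i)) (cong suc (ℕₚ.m+[n∸m]≡n i≤n))))))

  Series : Set c
  Series = ℕ → Carrier

  infix  4 _≈ₛ_
  infixl 6 _+ₛ_
  infixl 7 _*ₛ_
  infix  8 -ₛ_ _·t^_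

  _≈ₛ_ : Series → Series → Set ℓ
  f ≈ₛ g = ∀ n → f n ≈ g n

  _+ₛ_ _*ₛ_ : Series → Series → Series
  (f +ₛ g) n = f n + g n
  (f *ₛ g) n = Σ≤ n (λ i → f i * g (n ∸ i))

  -ₛ_ : Series → Series
  (-ₛ f) n = - f n

  0ₛ : Series
  0ₛ _ = 0#

  _·t^_ : Carrier → ℕ → Series
  (x ·t^ k) n = if n ≡ᵇ k then x else 0#

  1ₛ : Series
  1ₛ = 1# ·t^ 0

  *ₛ-cong : ∀ {f f′ g g′} → f ≈ₛ f′ → g ≈ₛ g′ → f *ₛ g ≈ₛ f′ *ₛ g′
  *ₛ-cong f≈f′ g≈g′ n = Σ≤-cong n λ i _ → *-cong (f≈f′ i) (g≈g′ (n ∸ i))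

  *ₛ-comm : ∀ f g → f *ₛ g ≈ₛ g *ₛ f
  *ₛ-comm f g n = begin
    Σ≤ n (λ i → f i * g (n ∸ i))               ≈⟨ Σ≤-reverse n _ ⟩
    Σ≤ n (λ i → f (n ∸ i) * g (n ∸ (n ∸ i)))   ≈⟨ Σ≤-cong n swap ⟩
    Σ≤ n (λ i → g i * f (n ∸ i))               ∎
    where
    swap : ∀ i → i ≤ n → f (n ∸ i) * g (n ∸ (n ∸ i)) ≈ g i * f (n ∸ i)
    swap i i≤n rewrite ℕₚ.m∸[m∸n]≡n i≤n = *-comm _ _

  *ₛ-assoc : ∀ f g h → (f *ₛ g) *ₛ h ≈ₛ f *ₛ (g *ₛ h)
  *ₛ-assoc f g h n = begin
    Σ≤ n (λ k → Σ≤ k (λ i → f i * g (k ∸ i)) * h (n ∸ k))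
      ≈⟨ Σ≤-cong n (λ k _ → *-distribʳ-Σ≤ k _ _) ⟩
    Σ≤ n (λ k → Σ≤ k (λ i → f i * g (k ∸ i) * h (n ∸ k)))
      ≈⟨ Σ≤-triangle n _ ⟩
    Σ≤ n (λ i → Σ≤ (n ∸ i) (λ j → f i * g (i ℕ.+ j ∸ i) * h (n ∸ (i ℕ.+ j))))
      ≈⟨ Σ≤-cong n (λ i _ → Σ≤-cong (n ∸ i) (λ j _ → reindex i j)) ⟩
    Σ≤ n (λ i → Σ≤ (n ∸ i) (λ j → f i * (g j * h (n ∸ i ∸ j))))
      ≈⟨ Σ≤-cong n (λ i _ → *-distribˡ-Σ≤ (n ∸ i) _ _) ⟨
    Σ≤ n (λ i → f i * Σ≤ (n ∸ i) (λ j → g j * h (n ∸ i ∸ j))) ∎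
    where
    reindex : ∀ i j → f i * g (i ℕ.+ j ∸ i) * h (n ∸ (i ℕ.+ j)) ≈ f i * (g j * h (n ∸ i ∸ j))
    reindex i j rewrite ℕₚ.m+n∸m≡n i j | ℕₚ.∸-+-assoc n i j = *-assoc _ _ _

  *ₛ-distribˡ : ∀ f g h → f *ₛ (g +ₛ h) ≈ₛ f *ₛ g +ₛ f *ₛ h
  *ₛ-distribˡ f g h n = trans (Σ≤-cong n λ i _ → distribˡ _ _ _) (Σ≤-distrib-+ n _ _)

  *ₛ-distribʳ : ∀ f g h → (g +ₛ h) *ₛ f ≈ₛ g *ₛ f +ₛ h *ₛ f
  *ₛ-distribʳ f g h n = trans (Σ≤-cong n λ i _ → distribʳ _ _ _) (Σ≤-distrib-+ n _ _)

  ·t^0-*ₛ : ∀ x f → x ·t^ 0 *ₛ f ≈ₛ (λ n → x * f n)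
  ·t^0-*ₛ x f zero    = ≈-refl
  ·t^0-*ₛ x f (suc n) = begin
    Σ≤ (suc n) (λ i → (x ·t^ 0) i * f (suc n ∸ i))   ≈⟨ Σ≤-suc n _ ⟩
    x * f (suc n) + Σ≤ n (λ i → 0# * f (n ∸ i))      ≈⟨ +-congˡ (Σ≤-zero n λ _ → zeroˡ _) ⟩
    x * f (suc n) + 0#                               ≈⟨ +-identityʳ _ ⟩
    x * f (suc n)                                    ∎

  ·t^suc-*ₛ : ∀ k x f n → (x ·t^ suc k *ₛ f) (suc n) ≈ (x ·t^ k *ₛ f) n
  ·t^suc-*ₛ k x f n = begin
    Σ≤ (suc n) (λ i → (x ·t^ suc k) i * f (suc n ∸ i))   ≈⟨ Σ≤-suc n _ ⟩
    0# * f (suc n) + (x ·t^ k *ₛ f) n                    ≈⟨ +-congʳ (zeroˡ _) ⟩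
    0# + (x ·t^ k *ₛ f) n                                ≈⟨ +-identityˡ _ ⟩
    (x ·t^ k *ₛ f) n                                     ∎

  ·t^-cong : ∀ k {x y} → x ≈ y → x ·t^ k ≈ₛ y ·t^ k
  ·t^-cong k x≈y n with n ≡ᵇ k
  ... | true  = x≈y
  ... | false = ≈-refl

  ·t^-*ₛ-·t^ : ∀ k l x y → x ·t^ k *ₛ y ·t^ l ≈ₛ (x * y) ·t^ (k ℕ.+ l)
  ·t^-*ₛ-·t^ zero    l x y n       = trans (·t^0-*ₛ x (y ·t^ l) n) (scale (n ≡ᵇ l))
    where
    scale : ∀ b → x * (if b then y else 0#) ≈ (if b then x * y else 0#)
    scale true  = ≈-refl
    scale false = zeroʳ x
  ·t^-*ₛ-·t^ (suc k) l x y zero    = zeroˡ _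
  ·t^-*ₛ-·t^ (suc k) l x y (suc n) = trans (·t^suc-*ₛ k x (y ·t^ l) n) (·t^-*ₛ-·t^ k l x y n)

  isCommutativeRingₛ : IsCommutativeRing _≈ₛ_ _+ₛ_ _*ₛ_ -ₛ_ 0ₛ 1ₛ
  isCommutativeRingₛ = record
    { isRing = record
      { +-isAbelianGroup = Pointwise.isAbelianGroup ℕ +-isAbelianGroup
      ; *-cong           = *ₛ-cong
      ; *-assoc          = *ₛ-assoc
      ; *-identity       = *ₛ-identityˡ , λ f n → trans (*ₛ-comm f 1ₛ n) (*ₛ-identityˡ f n)
      ; distrib          = *ₛ-distribˡ , *ₛ-distribʳ
      }
    ; *-comm = *ₛ-comm
    }
    where
    *ₛ-identityˡ : ∀ f → 1ₛ *ₛ f ≈ₛ f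
    *ₛ-identityˡ f n = trans (·t^0-*ₛ 1# f n) (*-identityˡ _)

  commutativeRingₛ : CommutativeRing c ℓ
  commutativeRingₛ = record { isCommutativeRing = isCommutativeRingₛ }

module ListSum {c ℓ} (R : CommutativeRing c ℓ) where

  open CommutativeRing R renaming (refl to ≈-refl)
  open import Relation.Binary.Reasoning.Setoid setoid
  open import Algebra.Properties.Ring ring using (-0#≈0#; -‿+-comm)

  ∑ : ∀ {a} {A : Set a} → List A → (A → Carrier) → Carrier
  ∑ []       f = 0#
  ∑ (x ∷ xs) f = f x + ∑ xs f

  module _ {a} {A : Set a} where

    ∑-cong : ∀ (xs : List A) {f g} → (∀ x → f x ≈ g x) → ∑ xs f ≈ ∑ xs g
    ∑-cong []       f≈g = ≈-refl
    ∑-cong (x ∷ xs) f≈g = +-cong (f≈g x) (∑-cong xs f≈g)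

    ∑-++ : ∀ (xs ys : List A) f → ∑ (xs ++ ys) f ≈ ∑ xs f + ∑ ys f
    ∑-++ []       ys f = sym (+-identityˡ _)
    ∑-++ (x ∷ xs) ys f = trans (+-congˡ (∑-++ xs ys f)) (sym (+-assoc _ _ _))

    ∑-map : ∀ {b} {B : Set b} (h : B → A) xs f → ∑ (map h xs) f ≡ ∑ xs (λ y → f (h y))
    ∑-map h []       f = refl
    ∑-map h (x ∷ xs) f = cong (_+_ (f (h x))) (∑-map h xs f)

    ∑-concatMap : ∀ {b} {B : Set b} (h : B → List A) xs f → ∑ (concatMap h xs) f ≈ ∑ xs (λ y → ∑ (h y) f)
    ∑-concatMap h []       f = ≈-refl
    ∑-concatMap h (x ∷ xs) f = trans (∑-++ (h x) (concatMap h xs) f) (+-congˡ (∑-concatMap h xs f))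

    *-distribˡ-∑ : ∀ x (xs : List A) f → x * ∑ xs f ≈ ∑ xs (λ y → x * f y)
    *-distribˡ-∑ x []       f = zeroʳ x
    *-distribˡ-∑ x (y ∷ xs) f = trans (distribˡ x _ _) (+-congˡ (*-distribˡ-∑ x xs f))

    ∑-distrib-− : ∀ (xs : List A) f g → ∑ xs (λ x → f x - g x) ≈ ∑ xs f - ∑ xs g
    ∑-distrib-− []       f g = sym (trans (+-congˡ -0#≈0#) (+-identityʳ 0#))
    ∑-distrib-− (x ∷ xs) f g = begin
      (f x - g x) + ∑ xs (λ x → f x - g x)      ≈⟨ +-congˡ (∑-distrib-− xs f g) ⟩
      (f x - g x) + (∑ xs f - ∑ xs g)           ≈⟨ interchange _ _ _ _ ⟩
      (f x + ∑ xs f) + (- g x - ∑ xs g)         ≈⟨ +-congˡ (-‿+-comm (g x) (∑ xs g)) ⟩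
      (f x + ∑ xs f) - (g x + ∑ xs g)           ∎
      where open import Algebra.Properties.CommutativeSemigroup +-commutativeSemigroup using (interchange)

    ∑-∷ʳ : ∀ (xs : List A) x f → ∑ (xs ∷ʳ x) f ≈ ∑ xs f + f x
    ∑-∷ʳ xs x f = trans (∑-++ xs (x ∷ []) f) (+-congˡ (+-identityʳ (f x)))

  ∑-upTo-suc : ∀ n f → ∑ (upTo (suc n)) f ≈ ∑ (upTo n) f + f n
  ∑-upTo-suc n f = trans (reflexive (cong (λ xs → ∑ xs f) (≡.sym (upTo-∷ʳ n)))) (∑-∷ʳ (upTo n) n f)

-- ℤ[[x,y,z,u]] is built as ℤ[[u]][[z]][[y]][[x]], whose carrier is definitionally PS.
module ℤ[[u]]       = PowerSeries ℤₚ.+-*-commutativeRing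
module ℤ[[z,u]]     = PowerSeries ℤ[[u]].commutativeRingₛ
module ℤ[[y,z,u]]   = PowerSeries ℤ[[z,u]].commutativeRingₛ
module ℤ[[x,y,z,u]] = PowerSeries ℤ[[y,z,u]].commutativeRingₛ

open ℤ[[x,y,z,u]] using (_*ₛ_)
open ℤ[[u]]       using () renaming (_·t^_ to _·u^_)
open ℤ[[z,u]]     using () renaming (_·t^_ to _·z^_)
open ℤ[[y,z,u]]   using () renaming (_·t^_ to _·y^_)
open ℤ[[x,y,z,u]] using () renaming (_·t^_ to _·x^_)

sumTo≡foldUpTo : ∀ n f → sumTo n f ≡ foldUpTo ℤ._+_ n f
sumTo≡foldUpTo zero    f = refl
sumTo≡foldUpTo (suc n) f = cong (ℤ._+ f (suc n)) (sumTo≡foldUpTo n f)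

sumTo-cong : ∀ n {f g : ℕ → ℤ} → (∀ i → i ≤ n → f i ≡ g i) → sumTo n f ≡ sumTo n g
sumTo-cong zero    f≡g = f≡g 0 z≤n
sumTo-cong (suc n) f≡g = cong₂ ℤ._+_ (sumTo-cong n λ i i≤n → f≡g i (ℕₚ.m≤n⇒m≤1+n i≤n)) (f≡g (suc n) ℕₚ.≤-refl)

sumTo-zero : ∀ n {f : ℕ → ℤ} → (∀ i → i ≤ n → f i ≡ 0ℤ) → sumTo n f ≡ 0ℤ
sumTo-zero zero    f≡0 = f≡0 0 z≤n
sumTo-zero (suc n) f≡0 = cong₂ ℤ._+_ (sumTo-zero n λ i i≤n → f≡0 i (ℕₚ.m≤n⇒m≤1+n i≤n)) (f≡0 (suc n) ℕₚ.≤-refl)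

sumTo-pad : ∀ {n K} {f : ℕ → ℤ} → n ≤ K → (∀ k → n < k → f k ≡ 0ℤ) → sumTo K f ≡ sumTo n f
sumTo-pad {K = zero}  z≤n f≡0 = refl
sumTo-pad {K = suc K} n≤1+K f≡0 with ℕₚ.m≤n⇒m<n∨m≡n n≤1+K
... | inj₂ refl      = refl
... | inj₁ (s≤s n≤K) = ≡.trans (cong₂ ℤ._+_ (sumTo-pad n≤K f≡0) (f≡0 (suc K) (s≤s n≤K))) (ℤₚ.+-identityʳ _)

⊗≈*ₛ : ∀ f g → (f ⊗ g) ≈ˢ (f *ₛ g)
⊗≈*ₛ f g a b c d = ≡.sym (begin
  (f *ₛ g) a b c d
    ≡⟨ cong (λ h → h c d) (foldUpTo-pointwise ℤ[[z,u]]._+ₛ_ a _ b) ⟩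
  foldUpTo ℤ[[z,u]]._+ₛ_ a (λ i → (f i ℤ[[y,z,u]].*ₛ g (a ∸ i)) b) c d
    ≡⟨ cong (λ h → h d) (foldUpTo-pointwise ℤ[[u]]._+ₛ_ a _ c) ⟩
  foldUpTo ℤ[[u]]._+ₛ_ a (λ i → (f i ℤ[[y,z,u]].*ₛ g (a ∸ i)) b c) d
    ≡⟨ foldUpTo-pointwise ℤ._+_ a _ d ⟩
  foldUpTo ℤ._+_ a (λ i → (f i ℤ[[y,z,u]].*ₛ g (a ∸ i)) b c d)
    ≡⟨ sumTo≡foldUpTo a _ ⟨
  sumTo a (λ i → (f i ℤ[[y,z,u]].*ₛ g (a ∸ i)) b c d)
    ≡⟨ sumTo-cong a (λ i _ → *ₛ³ (f i) (g (a ∸ i))) ⟩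
  (f ⊗ g) a b c d ∎)
  where
  open ≡.≡-Reasoning
  *ₛ¹ : ∀ f g → (f ℤ[[u]].*ₛ g) d ≡ sumTo d (λ l → f l ℤ.* g (d ∸ l))
  *ₛ¹ f g = ≡.sym (sumTo≡foldUpTo d _)
  *ₛ² : ∀ f g → (f ℤ[[z,u]].*ₛ g) c d ≡ sumTo c (λ k → sumTo d (λ l → f k l ℤ.* g (c ∸ k) (d ∸ l)))
  *ₛ² f g = ≡.trans (foldUpTo-pointwise ℤ._+_ c _ d)
    (≡.trans (≡.sym (sumTo≡foldUpTo c _)) (sumTo-cong c λ k _ → *ₛ¹ (f k) (g (c ∸ k))))
  *ₛ³ : ∀ f g → (f ℤ[[y,z,u]].*ₛ g) b c d
              ≡ sumTo b (λ j → sumTo c (λ k → sumTo d (λ l → f j k l ℤ.* g (b ∸ j) (c ∸ k) (d ∸ l))))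
  *ₛ³ f g = ≡.trans (cong (λ h → h d) (foldUpTo-pointwise ℤ[[u]]._+ₛ_ b _ c))
    (≡.trans (foldUpTo-pointwise ℤ._+_ b _ d)
    (≡.trans (≡.sym (sumTo≡foldUpTo b _)) (sumTo-cong b λ j _ → *ₛ² (f j) (g (b ∸ j)))))

monomial : ℤ → ℕ → ℕ → ℕ → ℕ → PS
monomial k α β γ δ = (((k ·u^ δ) ·z^ γ) ·y^ β) ·x^ α

mono≈monomial : ∀ α β γ δ → mono α β γ δ ≈ˢ monomial 1ℤ α β γ δ
mono≈monomial α β γ δ a b c d with a ≡ᵇ α
... | false = refl
... | true with b ≡ᵇ β
... | false = refl
... | true with c ≡ᵇ γ
... | false = refl
... | true with d ≡ᵇ δ
... | false = refl
... | true  = refl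

-- A record around ≈ˢ, so that both sides of an equation can be inferred from its type,
-- as the ring solver requires.
infix 4 _≋_
record _≋_ (f g : PS) : Set where
  constructor by-coefficients
  field coefficients : f ≈ˢ g
open _≋_ public

𝟘 : PS
𝟘 _ _ _ _ = 0ℤ

⊝_ : PS → PS
(⊝ f) a b c d = ℤ.- f a b c d

PS-isCommutativeRing : IsCommutativeRing _≋_ _⊕_ _⊗_ ⊝_ 𝟘 𝟙
PS-isCommutativeRing = record
  { isRing = record
    { +-isAbelianGroup = ⊕-isAbelianGroup
    ; *-cong           = ⊗-cong
    ; *-assoc          = ⊗-assoc
    ; *-identity       = ⊗-identityˡ , λ f → trans (⊗-comm f 𝟙) (⊗-identityˡ f)
    ; distrib          = ⊗-distribˡ , λ f g h → trans (⊗-comm (g ⊕ h) f)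
                           (trans (⊗-distribˡ f g h) (∙-cong (⊗-comm f g) (⊗-comm f h)))
    }
  ; *-comm = ⊗-comm
  }
  where
  module L = CommutativeRing ℤ[[x,y,z,u]].commutativeRingₛ

  ⊕-isAbelianGroup : IsAbelianGroup _≋_ _⊕_ 𝟘 ⊝_
  ⊕-isAbelianGroup = SubstEquality.isAbelianGroup (by-coefficients , coefficients) L.+-isAbelianGroup

  open IsAbelianGroup ⊕-isAbelianGroup using (setoid; trans; ∙-cong)
  open import Relation.Binary.Reasoning.Setoid setoid

  ⊗≋*ₛ : ∀ f g → f ⊗ g ≋ f *ₛ g
  ⊗≋*ₛ f g = by-coefficients (⊗≈*ₛ f g)

  *ₛ-cong : ∀ {f f′ g g′} → f ≋ f′ → g ≋ g′ → f *ₛ g ≋ f′ *ₛ g′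
  *ₛ-cong f≋f′ g≋g′ = by-coefficients (L.*-cong (coefficients f≋f′) (coefficients g≋g′))

  ⊗-cong : ∀ {f f′ g g′} → f ≋ f′ → g ≋ g′ → f ⊗ g ≋ f′ ⊗ g′
  ⊗-cong {f} {f′} {g} {g′} f≋f′ g≋g′ = begin
    f ⊗ g     ≈⟨ ⊗≋*ₛ f g ⟩
    f *ₛ g    ≈⟨ *ₛ-cong f≋f′ g≋g′ ⟩
    f′ *ₛ g′  ≈⟨ ⊗≋*ₛ f′ g′ ⟨
    f′ ⊗ g′   ∎

  ⊗-assoc : ∀ f g h → f ⊗ g ⊗ h ≋ f ⊗ (g ⊗ h)
  ⊗-assoc f g h = begin
    f ⊗ g ⊗ h        ≈⟨ ⊗≋*ₛ (f ⊗ g) h ⟩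
    (f ⊗ g) *ₛ h     ≈⟨ by-coefficients (L.*-congʳ {h} (⊗≈*ₛ f g)) ⟩
    (f *ₛ g) *ₛ h    ≈⟨ by-coefficients (L.*-assoc f g h) ⟩
    f *ₛ (g *ₛ h)    ≈⟨ by-coefficients (L.*-congˡ {f} (⊗≈*ₛ g h)) ⟨
    f *ₛ (g ⊗ h)     ≈⟨ ⊗≋*ₛ f (g ⊗ h) ⟨
    f ⊗ (g ⊗ h)      ∎

  ⊗-comm : ∀ f g → f ⊗ g ≋ g ⊗ f
  ⊗-comm f g = begin
    f ⊗ g    ≈⟨ ⊗≋*ₛ f g ⟩
    f *ₛ g   ≈⟨ by-coefficients (L.*-comm f g) ⟩
    g *ₛ f   ≈⟨ ⊗≋*ₛ g f ⟨
    g ⊗ f    ∎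

  ⊗-identityˡ : ∀ f → 𝟙 ⊗ f ≋ f
  ⊗-identityˡ f = begin
    𝟙 ⊗ f       ≈⟨ ⊗≋*ₛ 𝟙 f ⟩
    𝟙 *ₛ f      ≈⟨ by-coefficients (L.*-congʳ {f} (mono≈monomial 0 0 0 0)) ⟩
    L.1# *ₛ f   ≈⟨ by-coefficients (L.*-identityˡ f) ⟩
    f           ∎

  ⊗-distribˡ : ∀ f g h → f ⊗ (g ⊕ h) ≋ f ⊗ g ⊕ f ⊗ h
  ⊗-distribˡ f g h = begin
    f ⊗ (g ⊕ h)         ≈⟨ ⊗≋*ₛ f (g ⊕ h) ⟩
    f *ₛ (g ⊕ h)        ≈⟨ by-coefficients (L.distribˡ f g h) ⟩
    f *ₛ g ⊕ f *ₛ h     ≈⟨ ∙-cong (⊗≋*ₛ f g) (⊗≋*ₛ f h) ⟨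
    f ⊗ g ⊕ f ⊗ h       ∎

PS-commutativeRing : CommutativeRing 0ℓ 0ℓ
PS-commutativeRing = record { isCommutativeRing = PS-isCommutativeRing }

open CommutativeRing PS-commutativeRing using ()
  renaming (setoid to ≋-setoid; refl to ≋-refl; sym to ≋-sym; trans to ≋-trans; reflexive to ≋-reflexive;
            +-cong to ⊕-cong; *-cong to ⊗-cong; -‿cong to ⊝-cong; *-assoc to ⊗-assoc; *-comm to ⊗-comm;
            *-identityˡ to ⊗-identityˡ; *-identityʳ to ⊗-identityʳ)

module ≋-Reasoning = Relation.Binary.Reasoning.Setoid ≋-setoid

⊗-congˡ : ∀ f {g h} → g ≋ h → f ⊗ g ≋ f ⊗ h
⊗-congˡ f = ⊗-cong (≋-refl {f})

⊗-congʳ : ∀ h {f g} → f ≋ g → f ⊗ h ≋ g ⊗ h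
⊗-congʳ h f≋g = ⊗-cong f≋g (≋-refl {h})

⊖-cong : ∀ {f f′ g g′} → f ≋ f′ → g ≋ g′ → f ⊖ g ≋ f′ ⊖ g′
⊖-cong f≋f′ g≋g′ = ⊕-cong f≋f′ (⊝-cong g≋g′)

monomial-⊗ : ∀ k l α β γ δ α′ β′ γ′ δ′ → monomial k α β γ δ ⊗ monomial l α′ β′ γ′ δ′
  ≋ monomial (k ℤ.* l) (α ℕ.+ α′) (β ℕ.+ β′) (γ ℕ.+ γ′) (δ ℕ.+ δ′)
monomial-⊗ k l α β γ δ α′ β′ γ′ δ′ = by-coefficients λ a b c d →
  ≡.trans (⊗≈*ₛ (monomial k α β γ δ) (monomial l α′ β′ γ′ δ′) a b c d)
    (L₄.trans (ℤ[[x,y,z,u]].·t^-*ₛ-·t^ α α′ _ _)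
    (ℤ[[x,y,z,u]].·t^-cong (α ℕ.+ α′) (L₃.trans (ℤ[[y,z,u]].·t^-*ₛ-·t^ β β′ _ _)
    (ℤ[[y,z,u]].·t^-cong (β ℕ.+ β′) (L₂.trans (ℤ[[z,u]].·t^-*ₛ-·t^ γ γ′ _ _)
    (ℤ[[z,u]].·t^-cong (γ ℕ.+ γ′) (ℤ[[u]].·t^-*ₛ-·t^ δ δ′ k l)))))) a b c d)
  where
  module L₄ = CommutativeRing ℤ[[x,y,z,u]].commutativeRingₛ
  module L₃ = CommutativeRing ℤ[[y,z,u]].commutativeRingₛ
  module L₂ = CommutativeRing ℤ[[z,u]].commutativeRingₛ

module Solver where

  private
    scalar : ℤ → PS
    scalar k = monomial k 0 0 0 0

    scalar-+ : ∀ k l → scalar (k ℤ.+ l) ≈ˢ (scalar k ⊕ scalar l)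
    scalar-+ k l zero    zero    zero    zero    = refl
    scalar-+ k l (suc a) b       c       d       = refl
    scalar-+ k l zero    (suc b) c       d       = refl
    scalar-+ k l zero    zero    (suc c) d       = refl
    scalar-+ k l zero    zero    zero    (suc d) = refl

    scalar-neg : ∀ k → scalar (ℤ.- k) ≈ˢ (⊝ scalar k)
    scalar-neg k zero    zero    zero    zero    = refl
    scalar-neg k (suc a) b       c       d       = refl
    scalar-neg k zero    (suc b) c       d       = refl
    scalar-neg k zero    zero    (suc c) d       = refl
    scalar-neg k zero    zero    zero    (suc d) = refl

    scalar-0 : 𝟘 ≈ˢ scalar 0ℤ
    scalar-0 zero    zero    zero    zero    = refl
    scalar-0 (suc a) b       c       d       = refl
    scalar-0 zero    (suc b) c       d       = refl
    scalar-0 zero    zero    (suc c) d       = refl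
    scalar-0 zero    zero    zero    (suc d) = refl

    -- 0 and 1 go to 𝟘 and 𝟙 themselves, so that the solver's con 0ℤ and con 1ℤ are
    -- definitionally the constants of Defs.
    ⟦_⟧ : ℤ → PS
    ⟦ + 0 ⟧ = 𝟘
    ⟦ + 1 ⟧ = 𝟙
    ⟦ k   ⟧ = scalar k

    ⟦⟧≋scalar : ∀ k → ⟦ k ⟧ ≋ scalar k
    ⟦⟧≋scalar (+ 0)           = by-coefficients scalar-0
    ⟦⟧≋scalar (+ 1)           = by-coefficients (mono≈monomial 0 0 0 0)
    ⟦⟧≋scalar (+ suc (suc n)) = ≋-refl
    ⟦⟧≋scalar ℤ.-[1+ n ]      = ≋-refl

    ℤ⟶PS : CommutativeRing.rawRing ℤₚ.+-*-commutativeRing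
             -Raw-AlmostCommutative⟶ fromCommutativeRing PS-commutativeRing
    ℤ⟶PS = record
      { ⟦_⟧    = ⟦_⟧
      ; +-homo = λ k l → ≋-trans (⟦⟧≋scalar (k ℤ.+ l)) (≋-trans (by-coefficients (scalar-+ k l))
                           (≋-sym (⊕-cong (⟦⟧≋scalar k) (⟦⟧≋scalar l))))
      ; *-homo = λ k l → ≋-trans (⟦⟧≋scalar (k ℤ.* l)) (≋-sym (≋-trans (⊗-cong (⟦⟧≋scalar k) (⟦⟧≋scalar l))
                           (monomial-⊗ k l 0 0 0 0 0 0 0 0)))
      ; -‿homo = λ k → ≋-trans (⟦⟧≋scalar (ℤ.- k)) (≋-trans (by-coefficients (scalar-neg k))
                           (≋-sym (⊝-cong (⟦⟧≋scalar k))))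
      ; 0-homo = ≋-refl
      ; 1-homo = ≋-refl
      }

    ⟦⟧-≟ : ∀ k l → Maybe (⟦ k ⟧ ≋ ⟦ l ⟧)
    ⟦⟧-≟ k l with k ℤₚ.≟ l
    ... | yes refl = just ≋-refl
    ... | no _     = nothing

  open import Algebra.Solver.Ring (CommutativeRing.rawRing ℤₚ.+-*-commutativeRing)
    (fromCommutativeRing PS-commutativeRing) ℤ⟶PS ⟦⟧-≟
    using (solve; _:=_; con; _:+_; _:-_; _:*_) public

open Solver using (solve; _:=_; con; _:+_; _:-_; _:*_)

open ListSum PS-commutativeRing using (∑; ∑-cong; ∑-map; ∑-concatMap; *-distribˡ-∑; ∑-distrib-−; ∑-upTo-suc)

^ˢ-cong : ∀ {f g} n → f ≋ g → f ^ˢ n ≋ g ^ˢ n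
^ˢ-cong zero    f≋g = ≋-refl
^ˢ-cong (suc n) f≋g = ⊗-cong f≋g (^ˢ-cong n f≋g)

^ˢ-+ : ∀ f m n → f ^ˢ (m ℕ.+ n) ≋ f ^ˢ m ⊗ f ^ˢ n
^ˢ-+ f zero    n = ≋-sym (⊗-identityˡ (f ^ˢ n))
^ˢ-+ f (suc m) n = ≋-trans (⊗-congˡ f (^ˢ-+ f m n)) (≋-sym (⊗-assoc f (f ^ˢ m) (f ^ˢ n)))

^ˢ-* : ∀ f k n → f ^ˢ (k ℕ.* n) ≋ (f ^ˢ n) ^ˢ k
^ˢ-* f zero    n = ≋-refl
^ˢ-* f (suc k) n = ≋-trans (^ˢ-+ f n (k ℕ.* n)) (⊗-congˡ (f ^ˢ n) (^ˢ-* f k n))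

mono-cong : ∀ {α β γ δ α′ β′ γ′ δ′} → α ≡ α′ → β ≡ β′ → γ ≡ γ′ → δ ≡ δ′ → mono α β γ δ ≋ mono α′ β′ γ′ δ′
mono-cong refl refl refl refl = ≋-refl

mono-⊗ : ∀ α β γ δ α′ β′ γ′ δ′ →
  mono α β γ δ ⊗ mono α′ β′ γ′ δ′ ≋ mono (α ℕ.+ α′) (β ℕ.+ β′) (γ ℕ.+ γ′) (δ ℕ.+ δ′)
mono-⊗ α β γ δ α′ β′ γ′ δ′ = begin
  mono α β γ δ ⊗ mono α′ β′ γ′ δ′
    ≈⟨ ⊗-cong (by-coefficients (mono≈monomial α β γ δ)) (by-coefficients (mono≈monomial α′ β′ γ′ δ′)) ⟩
  monomial 1ℤ α β γ δ ⊗ monomial 1ℤ α′ β′ γ′ δ′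
    ≈⟨ monomial-⊗ 1ℤ 1ℤ α β γ δ α′ β′ γ′ δ′ ⟩
  monomial 1ℤ (α ℕ.+ α′) (β ℕ.+ β′) (γ ℕ.+ γ′) (δ ℕ.+ δ′)
    ≈⟨ by-coefficients (mono≈monomial (α ℕ.+ α′) (β ℕ.+ β′) (γ ℕ.+ γ′) (δ ℕ.+ δ′)) ⟨
  mono (α ℕ.+ α′) (β ℕ.+ β′) (γ ℕ.+ γ′) (δ ℕ.+ δ′) ∎
  where open ≋-Reasoning

mono-^ˢ : ∀ α β γ δ k → mono α β γ δ ^ˢ k ≋ mono (k ℕ.* α) (k ℕ.* β) (k ℕ.* γ) (k ℕ.* δ)
mono-^ˢ α β γ δ zero    = ≋-refl
mono-^ˢ α β γ δ (suc k) = ≋-trans (⊗-congˡ (mono α β γ δ) (mono-^ˢ α β γ δ k)) (mono-⊗ α β γ δ _ _ _ _)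

mono-⊗-U : ∀ α β → mono 0 α β 0 ⊗ U ≋ mono 0 α β 1
mono-⊗-U α β = ≋-trans (mono-⊗ 0 α β 0 0 0 0 1) (mono-cong refl (ℕₚ.+-identityʳ α) (ℕₚ.+-identityʳ β) refl)

Below : ℕ → ℕ → ℕ → ℕ → (ℕ → ℕ → ℕ → ℕ → Set) → Set
Below a b c d P = ∀ i j k l → i ≤ a → j ≤ b → k ≤ c → l ≤ d → P i j k l

⊗-term : PS → PS → ℕ → ℕ → ℕ → ℕ → ℕ → ℕ → ℕ → ℕ → ℤ
⊗-term f g a b c d i j k l = f i j k l ℤ.* g (a ∸ i) (b ∸ j) (c ∸ k) (d ∸ l)

⊗-coefficient-cong : ∀ f g f′ g′ a b c d →
  Below a b c d (λ i j k l → ⊗-term f g a b c d i j k l ≡ ⊗-term f′ g′ a b c d i j k l) →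
  (f ⊗ g) a b c d ≡ (f′ ⊗ g′) a b c d
⊗-coefficient-cong f g f′ g′ a b c d terms≡ =
  sumTo-cong a λ i i≤a → sumTo-cong b λ j j≤b → sumTo-cong c λ k k≤c → sumTo-cong d λ l l≤d →
    terms≡ i j k l i≤a j≤b k≤c l≤d

⊗-coefficient-zero : ∀ f g a b c d →
  Below a b c d (λ i j k l → ⊗-term f g a b c d i j k l ≡ 0ℤ) → (f ⊗ g) a b c d ≡ 0ℤ
⊗-coefficient-zero f g a b c d terms≡0 =
  sumTo-zero a λ i i≤a → sumTo-zero b λ j j≤b → sumTo-zero c λ k k≤c → sumTo-zero d λ l l≤d →
    terms≡0 i j k l i≤a j≤b k≤c l≤d

degree : ℕ → ℕ → ℕ → ℕ → ℕ
degree a b c d = a ℕ.+ b ℕ.+ c ℕ.+ d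

-- Σₙ and 1/1- of Defs truncate at total degree, so total degree is the order in which
-- infinite sums and products converge.
infix 4 ord_≥_
ord_≥_ : PS → ℕ → Set
ord f ≥ n = ∀ a b c d → degree a b c d < n → f a b c d ≡ 0ℤ

degree-∸ : ∀ {a b c d i j k l} → i ≤ a → j ≤ b → k ≤ c → l ≤ d →
  degree (a ∸ i) (b ∸ j) (c ∸ k) (d ∸ l) ℕ.+ degree i j k l ≡ degree a b c d
degree-∸ {a} {b} {c} {d} {i} {j} {k} {l} i≤a j≤b k≤c l≤d = begin
  degree (a ∸ i) (b ∸ j) (c ∸ k) (d ∸ l) ℕ.+ degree i j k l
    ≡⟨ regroup (a ∸ i) (b ∸ j) (c ∸ k) (d ∸ l) i j k l ⟩
  degree (a ∸ i ℕ.+ i) (b ∸ j ℕ.+ j) (c ∸ k ℕ.+ k) (d ∸ l ℕ.+ l)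
    ≡⟨ cong₂ (λ a′ b′ → degree a′ b′ _ _) (ℕₚ.m∸n+n≡m i≤a) (ℕₚ.m∸n+n≡m j≤b) ⟩
  degree a b (c ∸ k ℕ.+ k) (d ∸ l ℕ.+ l)
    ≡⟨ cong₂ (degree a b) (ℕₚ.m∸n+n≡m k≤c) (ℕₚ.m∸n+n≡m l≤d) ⟩
  degree a b c d ∎
  where
  open ≡.≡-Reasoning
  regroup : ∀ a b c d i j k l → a ℕ.+ b ℕ.+ c ℕ.+ d ℕ.+ (i ℕ.+ j ℕ.+ k ℕ.+ l)
                               ≡ a ℕ.+ i ℕ.+ (b ℕ.+ j) ℕ.+ (c ℕ.+ k) ℕ.+ (d ℕ.+ l)
  regroup = solve-∀

ord-⊗ : ∀ {m n} f g → ord f ≥ m → ord g ≥ n → ord (f ⊗ g) ≥ m ℕ.+ n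
ord-⊗ {m} {n} f g ord-f ord-g a b c d deg<m+n = ⊗-coefficient-zero f g a b c d term≡0
  where
  term≡0 : Below a b c d (λ i j k l → ⊗-term f g a b c d i j k l ≡ 0ℤ)
  term≡0 i j k l i≤a j≤b k≤c l≤d with degree i j k l ℕ.<? m
  ... | yes deg<m = cong (ℤ._* _) (ord-f i j k l deg<m)
  ... | no  deg≮m = ≡.trans (cong (f i j k l ℤ.*_) (ord-g _ _ _ _ rest<n)) (ℤₚ.*-zeroʳ (f i j k l))
    where
    rest<n : degree (a ∸ i) (b ∸ j) (c ∸ k) (d ∸ l) < n
    rest<n = ℕₚ.+-cancelʳ-< (degree i j k l) _ _ (begin-strict
      degree (a ∸ i) (b ∸ j) (c ∸ k) (d ∸ l) ℕ.+ degree i j k l  ≡⟨ degree-∸ i≤a j≤b k≤c l≤d ⟩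
      degree a b c d                                             <⟨ deg<m+n ⟩
      m ℕ.+ n                                                    ≤⟨ ℕₚ.+-monoˡ-≤ n (ℕₚ.≮⇒≥ deg≮m) ⟩
      degree i j k l ℕ.+ n                                       ≡⟨ ℕₚ.+-comm (degree i j k l) n ⟩
      n ℕ.+ degree i j k l                                       ∎)
      where open ℕₚ.≤-Reasoning

ord-⊗ʳ : ∀ {n} f g → ord g ≥ n → ord (f ⊗ g) ≥ n
ord-⊗ʳ f g = ord-⊗ f g (λ _ _ _ _ ())

ord-⊗ˡ : ∀ {n} f g → ord f ≥ n → ord (f ⊗ g) ≥ n
ord-⊗ˡ {n} f g ord-f = ≡.subst (ord (f ⊗ g) ≥_) (ℕₚ.+-identityʳ n) (ord-⊗ f g ord-f (λ _ _ _ _ ()))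

ord-U : ord U ≥ 1
ord-U zero    zero    zero    zero    _ = refl
ord-U (suc a) b       c       d       (s≤s ())
ord-U zero    (suc b) c       d       (s≤s ())
ord-U zero    zero    (suc c) d       (s≤s ())
ord-U zero    zero    zero    (suc d) (s≤s ())

ord-^ˢ : ∀ m → ord m ≥ 1 → ∀ k → ord (m ^ˢ k) ≥ k
ord-^ˢ m ord-m zero    _ _ _ _ ()
ord-^ˢ m ord-m (suc k) = ord-⊗ m (m ^ˢ k) ord-m (ord-^ˢ m ord-m k)

ord-prodTo : ∀ (B : ℕ → PS) → (∀ n → ord B n ≥ 1) → ∀ n → ord prodTo n B ≥ n
ord-prodTo B ord-B zero    _ _ _ _ ()
ord-prodTo B ord-B (suc n) = ≡.subst (ord prodTo (suc n) B ≥_) (ℕₚ.+-comm n 1)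
  (ord-⊗ (prodTo n B) (B n) (ord-prodTo B ord-B n) (ord-B n))

∑-upTo-coefficient : ∀ K (T : ℕ → PS) a b c d → ∑ (upTo (suc K)) T a b c d ≡ sumTo K (λ n → T n a b c d)
∑-upTo-coefficient zero    T a b c d = ℤₚ.+-identityʳ (T 0 a b c d)
∑-upTo-coefficient (suc K) T a b c d = ≡.trans (coefficients (∑-upTo-suc (suc K) T) a b c d)
  (cong (ℤ._+ T (suc K) a b c d) (∑-upTo-coefficient K T a b c d))

geometric-sum : ∀ m N → (𝟙 ⊖ m) ⊗ ∑ (upTo N) (m ^ˢ_) ≋ 𝟙 ⊖ m ^ˢ N
geometric-sum m zero    = solve 1 (λ m → (con 1ℤ :- m) :* con 0ℤ := con 1ℤ :- con 1ℤ) ≋-refl m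
geometric-sum m (suc N) = begin
  (𝟙 ⊖ m) ⊗ ∑ (upTo (suc N)) (m ^ˢ_)     ≈⟨ ⊗-congˡ (𝟙 ⊖ m) (∑-upTo-suc N (m ^ˢ_)) ⟩
  (𝟙 ⊖ m) ⊗ (S ⊕ m ^ˢ N)                ≈⟨ expand m S (m ^ˢ N) ⟩
  (𝟙 ⊖ m) ⊗ S ⊕ (m ^ˢ N ⊖ m ^ˢ suc N)   ≈⟨ ⊕-cong (geometric-sum m N) ≋-refl ⟩
  𝟙 ⊖ m ^ˢ N ⊕ (m ^ˢ N ⊖ m ^ˢ suc N)     ≈⟨ cancel (m ^ˢ N) (m ^ˢ suc N) ⟩
  𝟙 ⊖ m ^ˢ suc N                         ∎
  where
  open ≋-Reasoning
  S : PS
  S = ∑ (upTo N) (m ^ˢ_)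
  expand : ∀ m S P → (𝟙 ⊖ m) ⊗ (S ⊕ P) ≋ (𝟙 ⊖ m) ⊗ S ⊕ (P ⊖ m ⊗ P)
  expand = solve 3 (λ m S P → (con 1ℤ :- m) :* (S :+ P) := (con 1ℤ :- m) :* S :+ (P :- m :* P)) ≋-refl
  cancel : ∀ P P′ → 𝟙 ⊖ P ⊕ (P ⊖ P′) ≋ 𝟙 ⊖ P′
  cancel = solve 2 (λ P P′ → con 1ℤ :- P :+ (P :- P′) := con 1ℤ :- P′) ≋-refl

1/1-‿inverseˡ : ∀ m → ord m ≥ 1 → (1/1- m) ⊗ (𝟙 ⊖ m) ≋ 𝟙
1/1-‿inverseˡ m ord-m = by-coefficients λ a b c d → begin
  ((1/1- m) ⊗ (𝟙 ⊖ m)) a b c d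
    ≡⟨ ⊗-coefficient-cong (1/1- m) (𝟙 ⊖ m) (S (degree a b c d)) (𝟙 ⊖ m) a b c d (λ i j k l i≤a j≤b k≤c l≤d →
         cong (ℤ._* (𝟙 ⊖ m) (a ∸ i) (b ∸ j) (c ∸ k) (d ∸ l))
              (truncate i j k l (ℕₚ.+-mono-≤ (ℕₚ.+-mono-≤ (ℕₚ.+-mono-≤ i≤a j≤b) k≤c) l≤d))) ⟩
  (S (degree a b c d) ⊗ (𝟙 ⊖ m)) a b c d
    ≡⟨ coefficients (≋-trans (⊗-comm (S (degree a b c d)) (𝟙 ⊖ m)) (geometric-sum m (suc (degree a b c d)))) a b c d ⟩
  𝟙 a b c d ℤ.- (m ^ˢ suc (degree a b c d)) a b c d
    ≡⟨ cong (ℤ._-_ (𝟙 a b c d)) (ord-^ˢ m ord-m (suc (degree a b c d)) a b c d ℕₚ.≤-refl) ⟩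
  𝟙 a b c d ℤ.- 0ℤ
    ≡⟨ ℤₚ.+-identityʳ _ ⟩
  𝟙 a b c d ∎
  where
  open ≡.≡-Reasoning
  S : ℕ → PS
  S N = ∑ (upTo (suc N)) (m ^ˢ_)
  truncate : ∀ {N} i j k l → degree i j k l ≤ N → (1/1- m) i j k l ≡ S N i j k l
  truncate {N} i j k l deg≤N = ≡.sym (≡.trans (∑-upTo-coefficient N (m ^ˢ_) i j k l)
    (sumTo-pad deg≤N λ k′ deg<k′ → ord-^ˢ m ord-m k′ i j k l deg<k′))

1/1-‿cong : ∀ {f g} → f ≋ g → 1/1- f ≋ 1/1- g
1/1-‿cong f≋g = by-coefficients λ a b c d →
  sumTo-cong (degree a b c d) λ k _ → coefficients (^ˢ-cong k f≋g) a b c d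

Σₙ-cong : ∀ {S S′ : ℕ → PS} → (∀ n → S n ≋ S′ n) → Σₙ S ≈ˢ Σₙ S′
Σₙ-cong S≋S′ a b c d = sumTo-cong (degree a b c d) λ n _ → coefficients (S≋S′ n) a b c d

telescope-partial : ∀ (F A R : ℕ → PS) → (∀ n → F n ≋ A n ⊕ R n ⊗ F (suc n)) →
  ∀ N → F 0 ≋ ∑ (upTo N) (λ n → prodTo n R ⊗ A n) ⊕ prodTo N R ⊗ F N
telescope-partial F A R step zero    = solve 1 (λ F → F := con 0ℤ :+ con 1ℤ :* F) ≋-refl (F 0)
telescope-partial F A R step (suc N) = begin
  F 0                                                ≈⟨ telescope-partial F A R step N ⟩
  ∑ (upTo N) S ⊕ P ⊗ F N                             ≈⟨ ⊕-cong (≋-refl {∑ (upTo N) S}) (⊗-congˡ P (step N)) ⟩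
  ∑ (upTo N) S ⊕ P ⊗ (A N ⊕ R N ⊗ F (suc N))         ≈⟨ regroup (∑ (upTo N) S) P (A N) (R N) (F (suc N)) ⟩
  (∑ (upTo N) S ⊕ P ⊗ A N) ⊕ P ⊗ R N ⊗ F (suc N)     ≈⟨ ⊕-cong (∑-upTo-suc N S) (≋-refl {P ⊗ R N ⊗ F (suc N)}) ⟨
  ∑ (upTo (suc N)) S ⊕ prodTo (suc N) R ⊗ F (suc N)  ∎
  where
  open ≋-Reasoning
  S : ℕ → PS
  S n = prodTo n R ⊗ A n
  P : PS
  P = prodTo N R
  regroup : ∀ Σ P A R F → Σ ⊕ P ⊗ (A ⊕ R ⊗ F) ≋ (Σ ⊕ P ⊗ A) ⊕ P ⊗ R ⊗ F
  regroup = solve 5 (λ Σ P A R F → Σ :+ P :* (A :+ R :* F) := (Σ :+ P :* A) :+ P :* R :* F) ≋-refl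

telescope : ∀ (F A R : ℕ → PS) → (∀ n → F n ≋ A n ⊕ R n ⊗ F (suc n)) → (∀ n → ord R n ≥ 1) →
  F 0 ≈ˢ Σₙ (λ n → prodTo n R ⊗ A n)
telescope F A R step ord-R a b c d = begin
  F 0 a b c d
    ≡⟨ coefficients (telescope-partial F A R step (suc K)) a b c d ⟩
  ∑ (upTo (suc K)) S a b c d ℤ.+ (prodTo (suc K) R ⊗ F (suc K)) a b c d
    ≡⟨ cong₂ ℤ._+_ (∑-upTo-coefficient K S a b c d)
         (ord-⊗ˡ (prodTo (suc K) R) (F (suc K)) (ord-prodTo R ord-R (suc K)) a b c d ℕₚ.≤-refl) ⟩
  sumTo K (λ n → S n a b c d) ℤ.+ 0ℤ
    ≡⟨ ℤₚ.+-identityʳ _ ⟩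
  Σₙ S a b c d ∎
  where
  open ≡.≡-Reasoning
  K : ℕ
  K = degree a b c d
  S : ℕ → PS
  S n = prodTo n R ⊗ A n

-- Series that count Catalan words are defined one word length, that is one x-degree, at a
-- time, and so are the identities about them.
infix 4 _≡[x^_]_
_≡[x^_]_ : PS → ℕ → PS → Set
f ≡[x^ a ] g = ∀ b c d → f a b c d ≡ g a b c d

x-free : PS → Set
x-free h = ∀ a b c d → h (suc a) b c d ≡ 0ℤ

x-free-⊗ : ∀ f g → x-free f → x-free g → x-free (f ⊗ g)
x-free-⊗ f g f-free g-free a b c d = ⊗-coefficient-zero f g (suc a) b c d term≡0
  where
  term≡0 : Below (suc a) b c d (λ i j k l → ⊗-term f g (suc a) b c d i j k l ≡ 0ℤ)
  term≡0 zero    j k l _ _ _ _ = ≡.trans (cong (f 0 j k l ℤ.*_) (g-free a _ _ _)) (ℤₚ.*-zeroʳ (f 0 j k l))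
  term≡0 (suc i) j k l _ _ _ _ = cong (ℤ._* g (a ∸ i) (b ∸ j) (c ∸ k) (d ∸ l)) (f-free i j k l)

x-free-⊗-slice : ∀ h f g a → x-free h → f ≡[x^ a ] g → h ⊗ f ≡[x^ a ] h ⊗ g
x-free-⊗-slice h f g a h-free f≡g b c d = ⊗-coefficient-cong h f h g a b c d term≡
  where
  term≡ : Below a b c d (λ i j k l → ⊗-term h f a b c d i j k l ≡ ⊗-term h g a b c d i j k l)
  term≡ zero    j k l _ _ _ _ = cong (h 0 j k l ℤ.*_) (f≡g _ _ _)
  term≡ (suc i) j k l _ _ _ _ rewrite h-free i j k l = refl

X-⊗-slice : ∀ f g a → f ≡[x^ a ] g → X ⊗ f ≡[x^ suc a ] X ⊗ g
X-⊗-slice f g a f≡g b c d = ⊗-coefficient-cong X f X g (suc a) b c d term≡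
  where
  term≡ : Below (suc a) b c d (λ i j k l → ⊗-term X f (suc a) b c d i j k l ≡ ⊗-term X g (suc a) b c d i j k l)
  term≡ zero          j k l _ _ _ _ = refl
  term≡ (suc zero)    j k l _ _ _ _ = cong (X 1 j k l ℤ.*_) (f≡g _ _ _)
  term≡ (suc (suc i)) j k l _ _ _ _ = refl

X-⊗-slice-0 : ∀ f → X ⊗ f ≡[x^ 0 ] 𝟘
X-⊗-slice-0 f b c d = ⊗-coefficient-zero X f 0 b c d λ where
  zero j k l _ _ _ _ → refl

X-⊗-x-free : ∀ h a → x-free h → X ⊗ h ≡[x^ suc (suc a) ] 𝟘
X-⊗-x-free h a h-free b c d = ≡.trans (X-⊗-slice h 𝟘 (suc a) (h-free a) b c d)
  (coefficients (solve 1 (λ x → x :* con 0ℤ := con 0ℤ) ≋-refl X) (suc (suc a)) b c d)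

≡ᵇ-refl : ∀ n → (n ≡ᵇ n) ≡ true
≡ᵇ-refl zero    = refl
≡ᵇ-refl (suc n) = ≡ᵇ-refl n

≡ᵇ-sym : ∀ m n → (m ≡ᵇ n) ≡ (n ≡ᵇ m)
≡ᵇ-sym zero    zero    = refl
≡ᵇ-sym zero    (suc n) = refl
≡ᵇ-sym (suc m) zero    = refl
≡ᵇ-sym (suc m) (suc n) = ≡ᵇ-sym m n

𝟙[_] : Bool → ℤ
𝟙[ p ] = if p then 1ℤ else 0ℤ

mono-coefficient : ∀ a β γ δ b c d → mono a β γ δ a b c d ≡ 𝟙[ (β ≡ᵇ b) ∧ (γ ≡ᵇ c) ∧ (δ ≡ᵇ d) ]
mono-coefficient a β γ δ b c d rewrite ≡ᵇ-refl a | ≡ᵇ-sym b β | ≡ᵇ-sym c γ | ≡ᵇ-sym d δ = refl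

∑-indicator : ∀ ws (p : List ℕ → Bool) (g : List ℕ → PS) a b c d →
  (∀ w → g w a b c d ≡ 𝟙[ p w ]) → ∑ ws g a b c d ≡ + length (filterᵇ p ws)
∑-indicator []       p g a b c d g≡ = refl
∑-indicator (w ∷ ws) p g a b c d g≡ with p w | g≡ w
... | true  | gw≡1 = cong₂ ℤ._+_ gw≡1 (∑-indicator ws p g a b c d g≡)
... | false | gw≡0 = ≡.trans (cong₂ ℤ._+_ gw≡0 (∑-indicator ws p g a b c d g≡)) (ℤₚ.+-identityˡ _)

∑-coefficient-zero : ∀ ws (g : List ℕ → PS) a b c d → (∀ w → g w a b c d ≡ 0ℤ) → ∑ ws g a b c d ≡ 0ℤ
∑-coefficient-zero []       g a b c d g≡0 = refl
∑-coefficient-zero (w ∷ ws) g a b c d g≡0 =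
  ≡.trans (cong₂ ℤ._+_ (g≡0 w) (∑-coefficient-zero ws g a b c d g≡0)) (ℤₚ.+-identityˡ 0ℤ)

cells-∷ʳ : ∀ w v → if isOdd (length w)
  then oddCells (w ∷ʳ v) ≡ oddCells w × evenCells (w ∷ʳ v) ≡ evenCells w ℕ.+ suc v
  else oddCells (w ∷ʳ v) ≡ oddCells w ℕ.+ suc v × evenCells (w ∷ʳ v) ≡ evenCells w
cells-∷ʳ []       v = ℕₚ.+-identityʳ (suc v) , refl
cells-∷ʳ (x ∷ xs) v with isOdd (length xs) | cells-∷ʳ xs v
... | true  | odd≡ , even≡ = ≡.trans (cong (suc x ℕ.+_) even≡) (≡.sym (ℕₚ.+-assoc (suc x) _ (suc v))) , odd≡
... | false | odd≡ , even≡ = cong (suc x ℕ.+_) even≡ , odd≡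

length-∷ʳ : ∀ (w : List ℕ) v → length (w ∷ʳ v) ≡ suc (length w)
length-∷ʳ w v = ≡.trans (length-++ w) (ℕₚ.+-comm (length w) 1)

s-∷ʳ : ∀ w v → s (w ∷ʳ v) ≡ s̄ w ℕ.+ suc v
s-∷ʳ w v rewrite length-∷ʳ w v with isOdd (length w) | cells-∷ʳ w v
... | true  | _ , even≡ = even≡
... | false | odd≡ , _  = odd≡

s̄-∷ʳ : ∀ w v → s̄ (w ∷ʳ v) ≡ s w
s̄-∷ʳ w v rewrite length-∷ʳ w v with isOdd (length w) | cells-∷ʳ w v
... | true  | odd≡ , _  = odd≡
... | false | _ , even≡ = even≡

last-∷ʳ : ∀ w v → last (w ∷ʳ v) ≡ suc v
last-∷ʳ []           v = refl
last-∷ʳ (x ∷ [])     v = refl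
last-∷ʳ (x ∷ y ∷ ys) v = last-∷ʳ (y ∷ ys) v

data FG : Set where
  𝐅 𝐆 : FG

swap : FG → FG
swap 𝐅 = 𝐆
swap 𝐆 = 𝐅

yExp zExp : FG → List ℕ → ℕ
yExp 𝐅 = s
yExp 𝐆 = s̄
zExp 𝐅 = s̄
zExp 𝐆 = s

atOne : FG → PS
atOne 𝐅 = F1
atOne 𝐆 = G1

-- dilated 𝐅 i j = F(yⁱzʲu) and dilated 𝐆 i j = G(yⁱzʲu); dilated 𝐅 0 0 is F itself.
dilated : FG → ℕ → ℕ → PS
dilated σ i j a b c d = + length (filterᵇ (λ w →
  (i ℕ.* last w ℕ.+ yExp σ w ≡ᵇ b) ∧ (j ℕ.* last w ℕ.+ zExp σ w ≡ᵇ c) ∧ (last w ≡ᵇ d)) (catWords a))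

yStep zStep : FG → ℕ → ℕ
yStep 𝐅 i = suc i
yStep 𝐆 i = i
zStep 𝐅 j = j
zStep 𝐆 j = suc j

-- The weight of one cell of the last column in dilated σ i j (the t of the kernel equation).
cell : FG → ℕ → ℕ → PS
cell σ i j = mono 0 (yStep σ i) (zStep σ j) 1

-- The term of a word w in dilated σ i j. Its x-exponent a is a parameter instead of lth w:
-- the two agree on catWords a, and no proof needs that fact.
weight : FG → ℕ → ℕ → ℕ → List ℕ → PS
weight σ i j a w = mono a (i ℕ.* last w ℕ.+ yExp σ w) (j ℕ.* last w ℕ.+ zExp σ w) (last w)

weight₁ : FG → ℕ → List ℕ → PS
weight₁ σ a w = mono a (yExp σ w) (zExp σ w) 0

dilated-slice : ∀ σ i j a → dilated σ i j ≡[x^ a ] ∑ (catWords a) (weight σ i j a)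
dilated-slice σ i j a b c d = ≡.sym (∑-indicator (catWords a) _ (weight σ i j a) a b c d λ w →
  mono-coefficient a _ _ _ b c d)

∑-weight₁-u-free : ∀ σ a b c d → ∑ (catWords a) (weight₁ σ a) a b c (suc d) ≡ 0ℤ
∑-weight₁-u-free σ a b c d = ∑-coefficient-zero (catWords a) (weight₁ σ a) a b c (suc d) λ w →
  ≡.trans (mono-coefficient a (yExp σ w) (zExp σ w) 0 b c (suc d))
    (cong 𝟙[_] (≡.trans (cong ((yExp σ w ≡ᵇ b) ∧_) (∧-zeroʳ (zExp σ w ≡ᵇ c))) (∧-zeroʳ (yExp σ w ≡ᵇ b))))

atOne-slice : ∀ σ a → atOne σ ≡[x^ a ] ∑ (catWords a) (weight₁ σ a)
atOne-slice 𝐅 a b c zero    = ≡.sym (∑-indicator (catWords a) _ (weight₁ 𝐅 a) a b c 0 λ w →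
  ≡.trans (mono-coefficient a (s w) (s̄ w) 0 b c 0) (cong (λ p → 𝟙[ (s w ≡ᵇ b) ∧ p ]) (∧-identityʳ _)))
atOne-slice 𝐆 a b c zero    = ≡.sym (∑-indicator (catWords a) _ (weight₁ 𝐆 a) a b c 0 λ w →
  ≡.trans (mono-coefficient a (s̄ w) (s w) 0 b c 0)
    (cong 𝟙[_] (≡.trans (cong ((s̄ w ≡ᵇ b) ∧_) (∧-identityʳ _)) (∧-comm (s̄ w ≡ᵇ b) (s w ≡ᵇ c)))))
atOne-slice 𝐅 a b c (suc d) = ≡.sym (∑-weight₁-u-free 𝐅 a b c d)
atOne-slice 𝐆 a b c (suc d) = ≡.sym (∑-weight₁-u-free 𝐆 a b c d)

G≈dilated : G ≈ˢ dilated 𝐆 0 0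
G≈dilated a b c d = cong (λ ws → + length ws) (filter-≐ (T? ∘ p) (T? ∘ p′)
  ((λ {w} → ≡.subst Bool.T (p≡p′ w)) , (λ {w} → ≡.subst Bool.T (≡.sym (p≡p′ w)))) (catWords a))
  where
  p p′ : List ℕ → Bool
  p  w = (s w ≡ᵇ c) ∧ (s̄ w ≡ᵇ b) ∧ (last w ≡ᵇ d)
  p′ w = (s̄ w ≡ᵇ b) ∧ (s w ≡ᵇ c) ∧ (last w ≡ᵇ d)
  p≡p′ : ∀ w → p w ≡ p′ w
  p≡p′ w = ≡.trans (≡.sym (∧-assoc (s w ≡ᵇ c) _ _)) (≡.trans (cong (_∧ (last w ≡ᵇ d)) (∧-comm (s w ≡ᵇ c) _))
    (∧-assoc (s̄ w ≡ᵇ b) _ _))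

marked-column : ∀ i v S → i ℕ.* suc v ℕ.+ (S ℕ.+ suc v) ≡ S ℕ.+ suc v ℕ.* suc i
marked-column = solve-∀

unmarked-column : ∀ i v S → i ℕ.* suc v ℕ.+ S ≡ S ℕ.+ suc v ℕ.* i
unmarked-column = solve-∀

yExp-∷ʳ : ∀ σ i w v → i ℕ.* last (w ∷ʳ v) ℕ.+ yExp σ (w ∷ʳ v) ≡ yExp (swap σ) w ℕ.+ suc v ℕ.* yStep σ i
yExp-∷ʳ 𝐅 i w v rewrite last-∷ʳ w v | s-∷ʳ w v = marked-column i v (s̄ w)
yExp-∷ʳ 𝐆 i w v rewrite last-∷ʳ w v | s̄-∷ʳ w v = unmarked-column i v (s w)

zExp-∷ʳ : ∀ σ j w v → j ℕ.* last (w ∷ʳ v) ℕ.+ zExp σ (w ∷ʳ v) ≡ zExp (swap σ) w ℕ.+ suc v ℕ.* zStep σ j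
zExp-∷ʳ 𝐅 j w v rewrite last-∷ʳ w v | s̄-∷ʳ w v = unmarked-column j v (s w)
zExp-∷ʳ 𝐆 j w v rewrite last-∷ʳ w v | s-∷ʳ w v = marked-column j v (s̄ w)

weight₁-⊗-cell^ˢ : ∀ σ′ σ i j n w k → weight₁ σ′ n w ⊗ cell σ i j ^ˢ k
  ≋ mono n (yExp σ′ w ℕ.+ k ℕ.* yStep σ i) (zExp σ′ w ℕ.+ k ℕ.* zStep σ j) k
weight₁-⊗-cell^ˢ σ′ σ i j n w k =
  ≋-trans (⊗-congˡ (weight₁ σ′ n w) (mono-^ˢ 0 (yStep σ i) (zStep σ j) 1 k))
  (≋-trans (mono-⊗ n (yExp σ′ w) (zExp σ′ w) 0 (k ℕ.* 0) _ _ (k ℕ.* 1))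
  (mono-cong (≡.trans (cong (n ℕ.+_) (ℕₚ.*-zeroʳ k)) (ℕₚ.+-identityʳ n)) refl refl (ℕₚ.*-identityʳ k)))

weight-∷ʳ : ∀ σ i j n w v → weight σ i j (suc n) (w ∷ʳ v) ≋ X ⊗ (weight₁ (swap σ) n w ⊗ cell σ i j ^ˢ suc v)
weight-∷ʳ σ i j n w v = ≋-trans (mono-cong refl (yExp-∷ʳ σ i w v) (zExp-∷ʳ σ j w v) (last-∷ʳ w v))
  (≋-sym (≋-trans (⊗-congˡ X (weight₁-⊗-cell^ˢ (swap σ) σ i j n w (suc v))) (mono-⊗ 1 0 0 0 n _ _ _)))

weight-swap : ∀ σ i j n w →
  weight (swap σ) (yStep σ i) (zStep σ j) n w ≋ weight₁ (swap σ) n w ⊗ cell σ i j ^ˢ last w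
weight-swap σ i j n w = ≋-trans (mono-cong refl (comm (yStep σ i) _) (comm (zStep σ j) _) refl)
  (≋-sym (weight₁-⊗-cell^ˢ (swap σ) σ i j n w (last w)))
  where
  comm : ∀ e α → e ℕ.* last w ℕ.+ α ≡ α ℕ.+ last w ℕ.* e
  comm e α = ≡.trans (ℕₚ.+-comm (e ℕ.* last w) α) (cong (α ℕ.+_) (ℕₚ.*-comm e (last w)))

weight₁-[] : ∀ σ → weight₁ σ 0 [] ≋ 𝟙
weight₁-[] 𝐅 = ≋-refl
weight₁-[] 𝐆 = ≋-refl

module Kernel (σ : FG) (i j : ℕ) where

  T H H′ K : PS
  T  = cell σ i j
  H  = dilated σ i j
  H′ = dilated (swap σ) (yStep σ i) (zStep σ j)
  K  = atOne (swap σ)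

  extend-kernel : ∀ n w → (𝟙 ⊖ T) ⊗ ∑ (extend w) (weight σ i j (suc n))
    ≋ X ⊗ (T ⊗ (weight₁ (swap σ) n w ⊖ T ⊗ weight (swap σ) (yStep σ i) (zStep σ j) n w))
  extend-kernel n w = begin
    (𝟙 ⊖ T) ⊗ ∑ (extend w) (weight σ i j (suc n))
      ≈⟨ ⊗-congˡ (𝟙 ⊖ T) (≋-reflexive (∑-map (w ∷ʳ_) (upTo (suc (last w))) (weight σ i j (suc n)))) ⟩
    (𝟙 ⊖ T) ⊗ ∑ (upTo (suc (last w))) (λ v → weight σ i j (suc n) (w ∷ʳ v))
      ≈⟨ ⊗-congˡ (𝟙 ⊖ T) (∑-cong (upTo (suc (last w))) λ v →
           ≋-trans (weight-∷ʳ σ i j n w v) (regroup X Kw T (T ^ˢ v))) ⟩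
    (𝟙 ⊖ T) ⊗ ∑ (upTo (suc (last w))) (λ v → X ⊗ Kw ⊗ T ⊗ T ^ˢ v)
      ≈⟨ ⊗-congˡ (𝟙 ⊖ T) (*-distribˡ-∑ (X ⊗ Kw ⊗ T) (upTo (suc (last w))) (T ^ˢ_)) ⟨
    (𝟙 ⊖ T) ⊗ (X ⊗ Kw ⊗ T ⊗ ∑ (upTo (suc (last w))) (T ^ˢ_))
      ≈⟨ solve 3 (λ T P S → (con 1ℤ :- T) :* (P :* S) := P :* ((con 1ℤ :- T) :* S))
           ≋-refl T (X ⊗ Kw ⊗ T) (∑ (upTo (suc (last w))) (T ^ˢ_)) ⟩
    X ⊗ Kw ⊗ T ⊗ ((𝟙 ⊖ T) ⊗ ∑ (upTo (suc (last w))) (T ^ˢ_))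
      ≈⟨ ⊗-congˡ (X ⊗ Kw ⊗ T) (geometric-sum T (suc (last w))) ⟩
    X ⊗ Kw ⊗ T ⊗ (𝟙 ⊖ T ⊗ T ^ˢ last w)
      ≈⟨ solve 4 (λ X K T P → X :* K :* T :* (con 1ℤ :- T :* P) := X :* (T :* (K :- T :* (K :* P))))
           ≋-refl X Kw T (T ^ˢ last w) ⟩
    X ⊗ (T ⊗ (Kw ⊖ T ⊗ (Kw ⊗ T ^ˢ last w)))
      ≈⟨ ⊗-congˡ X (⊗-congˡ T (⊖-cong (≋-refl {Kw}) (⊗-congˡ T (weight-swap σ i j n w)))) ⟨
    X ⊗ (T ⊗ (Kw ⊖ T ⊗ weight (swap σ) (yStep σ i) (zStep σ j) n w)) ∎
    where
    open ≋-Reasoning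
    Kw : PS
    Kw = weight₁ (swap σ) n w
    regroup : ∀ X K T P → X ⊗ (K ⊗ (T ⊗ P)) ≋ X ⊗ K ⊗ T ⊗ P
    regroup = solve 4 (λ X K T P → X :* (K :* (T :* P)) := X :* K :* T :* P) ≋-refl

  concatMap-extend-kernel : ∀ n ws → (𝟙 ⊖ T) ⊗ ∑ (concatMap extend ws) (weight σ i j (suc n))
    ≋ X ⊗ (T ⊗ (∑ ws (weight₁ (swap σ) n) ⊖ T ⊗ ∑ ws (weight (swap σ) (yStep σ i) (zStep σ j) n)))
  concatMap-extend-kernel n ws = begin
    (𝟙 ⊖ T) ⊗ ∑ (concatMap extend ws) (weight σ i j (suc n))
      ≈⟨ ⊗-congˡ (𝟙 ⊖ T) (∑-concatMap extend ws (weight σ i j (suc n))) ⟩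
    (𝟙 ⊖ T) ⊗ ∑ ws (λ w → ∑ (extend w) (weight σ i j (suc n)))
      ≈⟨ *-distribˡ-∑ (𝟙 ⊖ T) ws _ ⟩
    ∑ ws (λ w → (𝟙 ⊖ T) ⊗ ∑ (extend w) (weight σ i j (suc n)))
      ≈⟨ ∑-cong ws (extend-kernel n) ⟩
    ∑ ws (λ w → X ⊗ (T ⊗ (Kw w ⊖ T ⊗ Hw w)))
      ≈⟨ *-distribˡ-∑ X ws _ ⟨
    X ⊗ ∑ ws (λ w → T ⊗ (Kw w ⊖ T ⊗ Hw w))
      ≈⟨ ⊗-congˡ X (*-distribˡ-∑ T ws _) ⟨
    X ⊗ (T ⊗ ∑ ws (λ w → Kw w ⊖ T ⊗ Hw w))
      ≈⟨ ⊗-congˡ X (⊗-congˡ T (∑-distrib-− ws Kw (λ w → T ⊗ Hw w))) ⟩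
    X ⊗ (T ⊗ (∑ ws Kw ⊖ ∑ ws (λ w → T ⊗ Hw w)))
      ≈⟨ ⊗-congˡ X (⊗-congˡ T (⊖-cong (≋-refl {∑ ws Kw}) (*-distribˡ-∑ T ws Hw))) ⟨
    X ⊗ (T ⊗ (∑ ws Kw ⊖ T ⊗ ∑ ws Hw)) ∎
    where
    open ≋-Reasoning
    Kw Hw : List ℕ → PS
    Kw = weight₁ (swap σ) n
    Hw = weight (swap σ) (yStep σ i) (zStep σ j) n

  W : PS
  W = 𝟙 ⊖ T ⊕ K ⊖ T ⊗ H′

  Hₐ Kₐ H′ₐ Wₐ : ℕ → PS
  Hₐ  a = ∑ (catWords a) (weight σ i j a)
  Kₐ  a = ∑ (catWords a) (weight₁ (swap σ) a)
  H′ₐ a = ∑ (catWords a) (weight (swap σ) (yStep σ i) (zStep σ j) a)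
  Wₐ  a = 𝟙 ⊖ T ⊕ Kₐ a ⊖ T ⊗ H′ₐ a

  singleton-kernel : (𝟙 ⊖ T) ⊗ ∑ (catWords 1) (weight σ i j 1) ≋ X ⊗ (T ⊗ Wₐ 0)
  singleton-kernel = begin
    (𝟙 ⊖ T) ⊗ (weight σ i j 1 ([] ∷ʳ 0) ⊕ 𝟘)
      ≈⟨ ⊗-congˡ (𝟙 ⊖ T) (⊕-cong (weight-∷ʳ σ i j 0 [] 0) (≋-refl {𝟘})) ⟩
    (𝟙 ⊖ T) ⊗ (X ⊗ (weight₁ (swap σ) 0 [] ⊗ (T ⊗ 𝟙)) ⊕ 𝟘)
      ≈⟨ ⊗-congˡ (𝟙 ⊖ T) (⊕-cong (⊗-congˡ X (⊗-congʳ (T ⊗ 𝟙) (weight₁-[] (swap σ)))) (≋-refl {𝟘})) ⟩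
    (𝟙 ⊖ T) ⊗ (X ⊗ (𝟙 ⊗ (T ⊗ 𝟙)) ⊕ 𝟘)
      ≈⟨ solve 2 (λ X T → (con 1ℤ :- T) :* (X :* (con 1ℤ :* (T :* con 1ℤ)) :+ con 0ℤ)
                        := X :* (T :* (con 1ℤ :- T :+ con 0ℤ :- T :* con 0ℤ))) ≋-refl X T ⟩
    X ⊗ (T ⊗ Wₐ 0) ∎
    where open ≋-Reasoning

  W-slice : ∀ a → W ≡[x^ a ] Wₐ a
  W-slice a b c d = cong₂ ℤ._-_ (cong (ℤ._+_ ((𝟙 ⊖ T) a b c d)) (atOne-slice (swap σ) a b c d))
    (x-free-⊗-slice T H′ (H′ₐ a) a (λ _ _ _ _ → refl) (dilated-slice (swap σ) (yStep σ i) (zStep σ j) a) b c d)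

  -- At a = 0 both sides vanish, so the junk value 0 ∸ 1 = 0 does no harm.
  sliced-kernel : ∀ a → (𝟙 ⊖ T) ⊗ Hₐ a ≡[x^ a ] X ⊗ (T ⊗ Wₐ (a ∸ 1))
  sliced-kernel zero          b c d = ≡.trans
    (coefficients (solve 1 (λ T → (con 1ℤ :- T) :* con 0ℤ := con 0ℤ) ≋-refl T) 0 b c d)
    (≡.sym (X-⊗-slice-0 (T ⊗ Wₐ 0) b c d))
  sliced-kernel (suc zero)    b c d = coefficients singleton-kernel 1 b c d
  sliced-kernel (suc (suc a)) b c d = begin
    ((𝟙 ⊖ T) ⊗ Hₐ (suc (suc a))) (suc (suc a)) b c d
      ≡⟨ coefficients (concatMap-extend-kernel (suc a) (catWords (suc a))) (suc (suc a)) b c d ⟩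
    rest
      ≡⟨ ≡.trans (cong (ℤ._+ rest) (X-⊗-x-free (T ⊗ (𝟙 ⊖ T)) a T⊗[𝟙⊖T]-x-free b c d)) (ℤₚ.+-identityˡ rest) ⟨
    (X ⊗ (T ⊗ (𝟙 ⊖ T)) ⊕ X ⊗ (T ⊗ (Kₐ (suc a) ⊖ T ⊗ H′ₐ (suc a)))) (suc (suc a)) b c d
      ≡⟨ coefficients (split X T (Kₐ (suc a)) (H′ₐ (suc a))) (suc (suc a)) b c d ⟨
    (X ⊗ (T ⊗ Wₐ (suc a))) (suc (suc a)) b c d ∎
    where
    open ≡.≡-Reasoning
    rest : ℤ
    rest = (X ⊗ (T ⊗ (Kₐ (suc a) ⊖ T ⊗ H′ₐ (suc a)))) (suc (suc a)) b c d
    T⊗[𝟙⊖T]-x-free : x-free (T ⊗ (𝟙 ⊖ T))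
    T⊗[𝟙⊖T]-x-free = x-free-⊗ T (𝟙 ⊖ T) (λ _ _ _ _ → refl) (λ _ _ _ _ → refl)
    split : ∀ X T K H → X ⊗ (T ⊗ (𝟙 ⊖ T ⊕ K ⊖ T ⊗ H)) ≋ X ⊗ (T ⊗ (𝟙 ⊖ T)) ⊕ X ⊗ (T ⊗ (K ⊖ T ⊗ H))
    split = solve 4 (λ X T K H → X :* (T :* (con 1ℤ :- T :+ K :- T :* H))
                              := X :* (T :* (con 1ℤ :- T)) :+ X :* (T :* (K :- T :* H))) ≋-refl

  kernel-equation : ((𝟙 ⊖ T) ⊗ H) ≈ˢ (X ⊗ (T ⊗ W))
  kernel-equation a b c d = begin
    ((𝟙 ⊖ T) ⊗ H) a b c d
      ≡⟨ x-free-⊗-slice (𝟙 ⊖ T) H (Hₐ a) a (λ _ _ _ _ → refl) (dilated-slice σ i j a) b c d ⟩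
    ((𝟙 ⊖ T) ⊗ Hₐ a) a b c d
      ≡⟨ sliced-kernel a b c d ⟩
    (X ⊗ (T ⊗ Wₐ (a ∸ 1))) a b c d
      ≡⟨ rhs-slice a b c d ⟨
    (X ⊗ (T ⊗ W)) a b c d ∎
    where
    open ≡.≡-Reasoning
    rhs-slice : ∀ a → X ⊗ (T ⊗ W) ≡[x^ a ] X ⊗ (T ⊗ Wₐ (a ∸ 1))
    rhs-slice zero    b c d = ≡.trans (X-⊗-slice-0 (T ⊗ W) b c d) (≡.sym (X-⊗-slice-0 (T ⊗ Wₐ 0) b c d))
    rhs-slice (suc a) = X-⊗-slice (T ⊗ W) (T ⊗ Wₐ a) a (x-free-⊗-slice T W (Wₐ a) a (λ _ _ _ _ → refl) (W-slice a))

  kernel-solution : ∀ D → D ⊗ (𝟙 ⊖ T) ≋ 𝟙 → H ≋ X ⊗ T ⊕ X ⊗ T ⊗ D ⊗ (K ⊖ T ⊗ H′)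
  kernel-solution D D-inverse = begin
    H                                               ≈⟨ ⊗-identityˡ H ⟨
    𝟙 ⊗ H                                           ≈⟨ ⊗-congʳ H D-inverse ⟨
    D ⊗ (𝟙 ⊖ T) ⊗ H                                 ≈⟨ ⊗-assoc D (𝟙 ⊖ T) H ⟩
    D ⊗ ((𝟙 ⊖ T) ⊗ H)                               ≈⟨ ⊗-congˡ D (by-coefficients kernel-equation) ⟩
    D ⊗ (X ⊗ (T ⊗ W))                               ≈⟨ regroup D X T K H′ ⟩
    X ⊗ T ⊗ (D ⊗ (𝟙 ⊖ T)) ⊕ X ⊗ T ⊗ D ⊗ (K ⊖ T ⊗ H′) ≈⟨ ⊕-cong (⊗-congˡ (X ⊗ T) D-inverse) (≋-refl {S}) ⟩
    X ⊗ T ⊗ 𝟙 ⊕ X ⊗ T ⊗ D ⊗ (K ⊖ T ⊗ H′)            ≈⟨ ⊕-cong (⊗-identityʳ (X ⊗ T)) (≋-refl {S}) ⟩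
    X ⊗ T ⊕ X ⊗ T ⊗ D ⊗ (K ⊖ T ⊗ H′)                ∎
    where
    open ≋-Reasoning
    S : PS
    S = X ⊗ T ⊗ D ⊗ (K ⊖ T ⊗ H′)
    regroup : ∀ D X T K H → D ⊗ (X ⊗ (T ⊗ (𝟙 ⊖ T ⊕ K ⊖ T ⊗ H)))
                          ≋ X ⊗ T ⊗ (D ⊗ (𝟙 ⊖ T)) ⊕ X ⊗ T ⊗ D ⊗ (K ⊖ T ⊗ H)
    regroup = solve 5 (λ D X T K H → D :* (X :* (T :* (con 1ℤ :- T :+ K :- T :* H)))
                                  := X :* T :* (D :* (con 1ℤ :- T)) :+ X :* T :* D :* (K :- T :* H)) ≋-refl

var : FG → PS
var 𝐅 = Y
var 𝐆 = Z

atOne-swap-swap : ∀ σ → atOne (swap (swap σ)) ≡ atOne σ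
atOne-swap-swap 𝐅 = refl
atOne-swap-swap 𝐆 = refl

dilated-swap-step : ∀ σ n →
  dilated (swap (swap σ)) (yStep (swap σ) (yStep σ n)) (zStep (swap σ) (zStep σ n)) ≡ dilated σ (suc n) (suc n)
dilated-swap-step 𝐅 n = refl
dilated-swap-step 𝐆 n = refl

cell-swap-step : ∀ σ n → cell (swap σ) (yStep σ n) (zStep σ n) ≡ mono 0 (suc n) (suc n) 1
cell-swap-step 𝐅 n = refl
cell-swap-step 𝐆 n = refl

var-⊗-var : ∀ σ → var σ ⊗ var (swap σ) ≋ mono 0 1 1 0
var-⊗-var 𝐅 = mono-⊗ 0 1 0 0 0 0 1 0
var-⊗-var 𝐆 = mono-⊗ 0 0 1 0 0 1 0 0

var-⊗-mono : ∀ σ n → var σ ⊗ mono 0 n n 0 ≋ mono 0 (yStep σ n) (zStep σ n) 0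
var-⊗-mono 𝐅 n = mono-⊗ 0 1 0 0 0 n n 0
var-⊗-mono 𝐆 n = mono-⊗ 0 0 1 0 0 n n 0

module Iteration (σ : FG) where

  y z q f1 g1 M : PS
  y  = var σ
  z  = var (swap σ)
  q  = y ⊗ z
  f1 = atOne σ
  g1 = atOne (swap σ)
  M  = X ⊗ X ⊗ y ⊗ y ⊗ U ⊗ U ⊗ U ⊗ U

  Tₙ T′ₙ Fₙ Gₙ Dₙ Eₙ Aₙ Bₙ termₙ ratioₙ : ℕ → PS
  Tₙ n     = cell σ n n
  T′ₙ n    = cell (swap σ) (yStep σ n) (zStep σ n)
  Fₙ n     = dilated σ n n
  Gₙ n     = dilated (swap σ) (yStep σ n) (zStep σ n)
  Dₙ n     = 1/1- (y ⊗ q ^ˢ n ⊗ U)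
  Eₙ n     = 1/1- (q ^ˢ suc n ⊗ U)
  Aₙ n     = X ⊗ y ⊗ q ^ˢ n ⊗ U
  Bₙ n     = X ⊗ X ⊗ y ⊗ y ⊗ q ^ˢ (1 ℕ.+ 3 ℕ.* n) ⊗ U ⊗ U ⊗ U
  termₙ n  = Aₙ n ⊕ Aₙ n ⊗ Dₙ n ⊗ g1 ⊖ Bₙ n ⊗ Dₙ n ⊖ Bₙ n ⊗ Dₙ n ⊗ Eₙ n ⊗ f1
  ratioₙ n = M ⊗ q ^ˢ (2 ℕ.+ 4 ℕ.* n) ⊗ Dₙ n ⊗ Eₙ n

  q^ˢ : ∀ n → q ^ˢ n ≋ mono 0 n n 0
  q^ˢ n = ≋-trans (^ˢ-cong n (var-⊗-var σ)) (≋-trans (mono-^ˢ 0 1 1 0 n)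
    (mono-cong (ℕₚ.*-zeroʳ n) (ℕₚ.*-identityʳ n) (ℕₚ.*-identityʳ n) (ℕₚ.*-zeroʳ n)))

  F-cell : ∀ n → y ⊗ q ^ˢ n ⊗ U ≋ Tₙ n
  F-cell n = ≋-trans (⊗-congʳ U (≋-trans (⊗-congˡ y (q^ˢ n)) (var-⊗-mono σ n))) (mono-⊗-U _ _)

  G-cell : ∀ n → q ^ˢ suc n ⊗ U ≋ T′ₙ n
  G-cell n = ≋-trans (⊗-congʳ U (q^ˢ (suc n)))
    (≋-trans (mono-⊗-U (suc n) (suc n)) (≋-reflexive (≡.sym (cell-swap-step σ n))))

  F-step : ∀ n → Fₙ n ≋ X ⊗ Tₙ n ⊕ X ⊗ Tₙ n ⊗ Dₙ n ⊗ (g1 ⊖ Tₙ n ⊗ Gₙ n)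
  F-step n = Kernel.kernel-solution σ n n (Dₙ n)
    (≋-trans (⊗-congˡ (Dₙ n) (⊖-cong (≋-refl {𝟙}) (≋-sym (F-cell n))))
             (1/1-‿inverseˡ (y ⊗ q ^ˢ n ⊗ U) (ord-⊗ʳ (y ⊗ q ^ˢ n) U ord-U)))

  G-step : ∀ n → Gₙ n ≋ X ⊗ T′ₙ n ⊕ X ⊗ T′ₙ n ⊗ Eₙ n ⊗ (f1 ⊖ T′ₙ n ⊗ Fₙ (suc n))
  G-step n = ≋-trans (Kernel.kernel-solution (swap σ) (yStep σ n) (zStep σ n) (Eₙ n)
    (≋-trans (⊗-congˡ (Eₙ n) (⊖-cong (≋-refl {𝟙}) (≋-sym (G-cell n))))
             (1/1-‿inverseˡ (q ^ˢ suc n ⊗ U) (ord-⊗ʳ (q ^ˢ suc n) U ord-U))))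
    (≋-reflexive (cong₂ (λ K H → X ⊗ T′ₙ n ⊕ X ⊗ T′ₙ n ⊗ Eₙ n ⊗ (K ⊖ T′ₙ n ⊗ H))
      (atOne-swap-swap σ) (dilated-swap-step σ n)))

  substitute : ∀ A D g t A′ E f t′ F′ →
    A ⊕ A ⊗ D ⊗ (g ⊖ t ⊗ (A′ ⊕ A′ ⊗ E ⊗ (f ⊖ t′ ⊗ F′)))
    ≋ A ⊕ A ⊗ D ⊗ g ⊖ A ⊗ t ⊗ A′ ⊗ D ⊖ A ⊗ t ⊗ A′ ⊗ D ⊗ E ⊗ f ⊕ A ⊗ t ⊗ A′ ⊗ t′ ⊗ D ⊗ E ⊗ F′
  substitute = solve 9 (λ A D g t A′ E f t′ F′ →
    A :+ A :* D :* (g :- t :* (A′ :+ A′ :* E :* (f :- t′ :* F′)))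
    := A :+ A :* D :* g :- A :* t :* A′ :* D :- A :* t :* A′ :* D :* E :* f
       :+ A :* t :* A′ :* t′ :* D :* E :* F′) ≋-refl

  A-form : ∀ n → X ⊗ Tₙ n ≋ Aₙ n
  A-form n = ≋-trans (⊗-congˡ X (≋-sym (F-cell n)))
    (solve 4 (λ X y Q U → X :* (y :* Q :* U) := X :* y :* Q :* U) ≋-refl X y (q ^ˢ n) U)

  B-form : ∀ n → X ⊗ Tₙ n ⊗ Tₙ n ⊗ (X ⊗ T′ₙ n) ≋ Bₙ n
  B-form n = begin
    X ⊗ Tₙ n ⊗ Tₙ n ⊗ (X ⊗ T′ₙ n)
      ≈⟨ ⊗-cong (⊗-cong (⊗-congˡ X (≋-sym (F-cell n))) (≋-sym (F-cell n))) (⊗-congˡ X (≋-sym (G-cell n))) ⟩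
    X ⊗ (y ⊗ Q ⊗ U) ⊗ (y ⊗ Q ⊗ U) ⊗ (X ⊗ (q ⊗ Q ⊗ U))
      ≈⟨ solve 5 (λ X y q Q U → X :* (y :* Q :* U) :* (y :* Q :* U) :* (X :* (q :* Q :* U))
           := X :* X :* y :* y :* (q :* (Q :* (Q :* (Q :* con 1ℤ)))) :* U :* U :* U) ≋-refl X y q Q U ⟩
    X ⊗ X ⊗ y ⊗ y ⊗ (q ⊗ (Q ⊗ (Q ⊗ (Q ⊗ 𝟙)))) ⊗ U ⊗ U ⊗ U
      ≈⟨ ⊗-congʳ U (⊗-congʳ U (⊗-congʳ U (⊗-congˡ (X ⊗ X ⊗ y ⊗ y) (⊗-congˡ q (^ˢ-* q 3 n))))) ⟨
    Bₙ n ∎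
    where
    open ≋-Reasoning
    Q : PS
    Q = q ^ˢ n

  ratio-form : ∀ n → X ⊗ Tₙ n ⊗ Tₙ n ⊗ (X ⊗ T′ₙ n) ⊗ T′ₙ n ≋ M ⊗ q ^ˢ (2 ℕ.+ 4 ℕ.* n)
  ratio-form n = begin
    X ⊗ Tₙ n ⊗ Tₙ n ⊗ (X ⊗ T′ₙ n) ⊗ T′ₙ n
      ≈⟨ ⊗-cong (B-form n) (≋-sym (G-cell n)) ⟩
    Bₙ n ⊗ (q ⊗ q ^ˢ n ⊗ U)
      ≈⟨ solve 6 (λ X y P q Q U → X :* X :* y :* y :* P :* U :* U :* U :* (q :* Q :* U)
           := X :* X :* y :* y :* U :* U :* U :* U :* (P :* (q :* Q)))
           ≋-refl X y (q ^ˢ (1 ℕ.+ 3 ℕ.* n)) q (q ^ˢ n) U ⟩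
    M ⊗ (q ^ˢ (1 ℕ.+ 3 ℕ.* n) ⊗ q ^ˢ suc n)
      ≈⟨ ⊗-congˡ M (≋-trans (≋-reflexive (cong (q ^ˢ_) (≡.sym (exponent n)))) (^ˢ-+ q (1 ℕ.+ 3 ℕ.* n) (suc n))) ⟨
    M ⊗ q ^ˢ (2 ℕ.+ 4 ℕ.* n) ∎
    where
    open ≋-Reasoning
    exponent : ∀ n → 1 ℕ.+ 3 ℕ.* n ℕ.+ suc n ≡ 2 ℕ.+ 4 ℕ.* n
    exponent = solve-∀

  two-step : ∀ n → Fₙ n ≋ termₙ n ⊕ ratioₙ n ⊗ Fₙ (suc n)
  two-step n = begin
    Fₙ n
      ≈⟨ F-step n ⟩
    X ⊗ T ⊕ X ⊗ T ⊗ D ⊗ (g1 ⊖ T ⊗ Gₙ n)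
      ≈⟨ ⊕-cong (≋-refl {X ⊗ T}) (⊗-congˡ (X ⊗ T ⊗ D) (⊖-cong (≋-refl {g1}) (⊗-congˡ T (G-step n)))) ⟩
    X ⊗ T ⊕ X ⊗ T ⊗ D ⊗ (g1 ⊖ T ⊗ (X ⊗ T′ ⊕ X ⊗ T′ ⊗ E ⊗ (f1 ⊖ T′ ⊗ Fₙ (suc n))))
      ≈⟨ substitute (X ⊗ T) D g1 T (X ⊗ T′) E f1 T′ (Fₙ (suc n)) ⟩
    X ⊗ T ⊕ X ⊗ T ⊗ D ⊗ g1 ⊖ B′ ⊗ D ⊖ B′ ⊗ D ⊗ E ⊗ f1 ⊕ B′ ⊗ T′ ⊗ D ⊗ E ⊗ Fₙ (suc n)
      ≈⟨ ⊕-cong (⊖-cong (⊖-cong (⊕-cong (A-form n) (⊗-congʳ g1 (⊗-congʳ D (A-form n)))) (⊗-congʳ D (B-form n)))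
                        (⊗-congʳ f1 (⊗-congʳ E (⊗-congʳ D (B-form n)))))
                (⊗-congʳ (Fₙ (suc n)) (⊗-congʳ E (⊗-congʳ D (ratio-form n)))) ⟩
    termₙ n ⊕ ratioₙ n ⊗ Fₙ (suc n) ∎
    where
    open ≋-Reasoning
    T T′ D E B′ : PS
    T  = Tₙ n
    T′ = T′ₙ n
    D  = Dₙ n
    E  = Eₙ n
    B′ = X ⊗ T ⊗ T ⊗ (X ⊗ T′)

  ratio-product : ∀ n → prodTo n ratioₙ ≋ M ^ˢ n ⊗ q ^ˢ (2 ℕ.* n ℕ.* n) ⊗ 1/qPoch (y ⊗ U) q n ⊗ 1/qPoch (q ⊗ U) q n
  ratio-product zero    = solve 0 (con 1ℤ := con 1ℤ :* con 1ℤ :* con 1ℤ :* con 1ℤ) ≋-refl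
  ratio-product (suc n) = begin
    prodTo n ratioₙ ⊗ ratioₙ n
      ≈⟨ ⊗-congʳ (ratioₙ n) (ratio-product n) ⟩
    Mₙ ⊗ Q₂ ⊗ Py ⊗ Pq ⊗ (M ⊗ Qₑ ⊗ Dₙ n ⊗ Eₙ n)
      ≈⟨ solve 8 (λ Mₙ Q₂ Py Pq M Qₑ D E → Mₙ :* Q₂ :* Py :* Pq :* (M :* Qₑ :* D :* E)
           := M :* Mₙ :* (Q₂ :* Qₑ) :* (Py :* D) :* (Pq :* E)) ≋-refl Mₙ Q₂ Py Pq M Qₑ (Dₙ n) (Eₙ n) ⟩
    M ⊗ Mₙ ⊗ (Q₂ ⊗ Qₑ) ⊗ (Py ⊗ Dₙ n) ⊗ (Pq ⊗ Eₙ n)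
      ≈⟨ ⊗-cong (⊗-cong (⊗-congˡ (M ⊗ Mₙ) Q≋) (⊗-congˡ Py (1/1-‿cong (swap-U y))))
                (⊗-congˡ Pq (1/1-‿cong (swap-U q))) ⟩
    M ^ˢ suc n ⊗ q ^ˢ (2 ℕ.* suc n ℕ.* suc n) ⊗ 1/qPoch (y ⊗ U) q (suc n) ⊗ 1/qPoch (q ⊗ U) q (suc n) ∎
    where
    open ≋-Reasoning
    Mₙ Q₂ Qₑ Py Pq : PS
    Mₙ = M ^ˢ n
    Q₂ = q ^ˢ (2 ℕ.* n ℕ.* n)
    Qₑ = q ^ˢ (2 ℕ.+ 4 ℕ.* n)
    Py = 1/qPoch (y ⊗ U) q n
    Pq = 1/qPoch (q ⊗ U) q n
    exponent : ∀ n → 2 ℕ.* suc n ℕ.* suc n ≡ 2 ℕ.* n ℕ.* n ℕ.+ (2 ℕ.+ 4 ℕ.* n)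
    exponent = solve-∀
    Q≋ : Q₂ ⊗ Qₑ ≋ q ^ˢ (2 ℕ.* suc n ℕ.* suc n)
    Q≋ = ≋-sym (≋-trans (≋-reflexive (cong (q ^ˢ_) (exponent n))) (^ˢ-+ q (2 ℕ.* n ℕ.* n) (2 ℕ.+ 4 ℕ.* n)))
    swap-U : ∀ a → a ⊗ q ^ˢ n ⊗ U ≋ a ⊗ U ⊗ q ^ˢ n
    swap-U a = solve 3 (λ a Q U → a :* Q :* U := a :* U :* Q) ≋-refl a (q ^ˢ n) U

  ord-ratio : ∀ n → ord ratioₙ n ≥ 1
  ord-ratio n = ord-⊗ˡ (M ⊗ q ^ˢ (2 ℕ.+ 4 ℕ.* n) ⊗ Dₙ n) (Eₙ n) (ord-⊗ˡ (M ⊗ q ^ˢ (2 ℕ.+ 4 ℕ.* n)) (Dₙ n)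
    (ord-⊗ˡ M (q ^ˢ (2 ℕ.+ 4 ℕ.* n)) (ord-⊗ʳ (X ⊗ X ⊗ y ⊗ y ⊗ U ⊗ U ⊗ U) U ord-U)))

  expansion : Fₙ 0 ≈ˢ RHS y z f1 g1
  expansion a b c d = ≡.trans (telescope Fₙ termₙ ratioₙ two-step ord-ratio a b c d)
    (Σₙ-cong (λ n → ⊗-congʳ (termₙ n) (ratio-product n)) a b c d)

theorem5p5 : (F ≈ˢ RHS Y Z F1 G1) × (G ≈ˢ RHS Z Y G1 F1)
theorem5p5 = Iteration.expansion 𝐅 , λ a b c d → ≡.trans (G≈dilated a b c d) (Iteration.expansion 𝐆 a b c d)
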